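{- Let $\Gamma$ be a set of second-order formulas (a context) and $A$ a second-order formula, and let $k\in\{i,c\}$. If $\Gamma\vdash^2_k A$, then $\Gamma^*,SC_1\vdash^1_k A^*$.
   Context: The second-order language $\mathcal L_2$ has logical symbols $\bot,\to,\wedge,\vee,\forall,\exists$; a countable set $\mathcal V$ of first-order variables; a countable set $\Sigma$ of function symbols (constants have arity $0$), from which terms are built; and for each $n\in\mathbb N$ a countable set $\mathcal V_n$ of second-order variables of arity $n$. Its atomic formulas are $\bot$ and $X^n(t_1,\dots,t_n)$, and it has quantification over first-order variables and over second-order variables of every arity. The first-order language $\mathcal L_1$ has the same $\mathcal V$, $\Sigma$ and logical symbols, and for each $n\in\mathbb N$ one relation symbol $\mathrm{Ap}_n$ of arity $n+1$ (and no others). $\mathrm{Free}(F)$ denotes the set of free variables, and $F\leftrightarrow G$ abbreviates $(F\to G)\wedge(G\to F)$. $\Gamma\vdash^n_k F$ denotes natural-deduction derivability, in first-order logic over $\mathcal L_1$ for $n=1$ and in second-order logic over $\mathcal L_2$ for $n=2$ (where second-order $\forall$-elimination and $\exists$-introduction instantiate $X^n$ by an arbitrary abstraction $\lambda x_1\dots x_n\,G$); the logic is intuitionistic for $k=i$ and classical for $k=c$. Fix for each $n$ a bijection $\phi_n:\mathcal V_n\to\mathcal V$. The coding $F\mapsto F^*$ of $\mathcal L_2$-formulas into $\mathcal L_1$-formulas is defined by: - $\bot^*=\bot$ and $(X^n(t_1,\dots,t_n))^*=\mathrm{Ap}_n(\phi_n(X^n),t_1,\dots,t_n)$. - $(A\diamond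 B)^*=A^*\diamond B^*$ for $\diamond\in\{\to,\wedge,\vee\}$. - $(Qx\,A)^*=Qy\,(A[x:=y])^*$ for a variable $y\notin\mathrm{Free}(A^*)$. - $(QX^n\,A)^*=Qy\,(A[X^n:=Y^n])^*$, where $\phi_n(Y^n)=y$ and $y\notin\mathrm{Free}(A^*)$. Here $Q\in\{\forall,\exists\}$. For a set of formulas, $\Gamma^*=\{F^*:F\in\Gamma\}$. $SC_2$ is the set of all closed $\mathcal L_2$-formulas $\forall\chi_1\dots\forall\chi_m\,\exists X^n\,\forall x_1\dots\forall x_n\,(G\leftrightarrow X^n(x_1,\dots,x_n))$, where $x_j\in\mathcal V$, the $\chi_j$ are first- or second-order variables, $\mathrm{Free}(G)\subseteq\{x_1,\dots,x_n,\chi_1,\dots,\chi_m\}$, and $X^n\notin\mathrm{Free}(G)$. Finally, $SC_1=\{F^*:F\in SC_2\}$. -}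

module Defs where

open import Data.Nat using (ℕ; zero; suc; _⊔_; _≡ᵇ_; _≟_)
open import Data.Fin using (toℕ)
open import Data.Bool using (if_then_else_) renaming (_∧_ to _∧ᵇ_)
open import Data.Vec as V using (Vec; []; _∷_)
open import Data.List as L using (List; []; _∷_; _++_)
open import Data.List.Membership.Propositional using (_∈_; _∉_)
open import Data.List.Relation.Unary.All using (All)
import Data.List.Relation.Unary.Any as Any
open import Data.Product using (Σ; _×_; _,_; proj₁; proj₂)
open import Data.Product.Properties using (≡-dec)
open import Data.Sum using (_⊎_; inj₁; inj₂)
open import Relation.Nullary using (yes; no; ¬?)
open import Relation.Binary.PropositionalEquality using (_≡_; refl)
open import Function.Bundles using (_⤖_; Bijection)

-- Conventions
--  * first-order variables 𝒱 = ℕ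
--  * second-order variables of arity n: 𝒱ₙ = ℕ (a second-order variable
--    is a pair (n , X) : arity and name)
--  * function symbols Σ = ℕ, symbol f having arity  ar f  (ar is a
--    parameter of everything: an arbitrary countable signature)

data Term (ar : ℕ → ℕ) : Set where
  var : ℕ → Term ar
  fun : (f : ℕ) → Vec (Term ar) (ar f) → Term ar

data Form1 (ar : ℕ → ℕ) : Set where
  ⊥₁   : Form1 ar
  Ap   : (n : ℕ) → Vec (Term ar) (suc n) → Form1 ar
  _⇒₁_ : Form1 ar → Form1 ar → Form1 ar
  _∧₁_ : Form1 ar → Form1 ar → Form1 ar
  _∨₁_ : Form1 ar → Form1 ar → Form1 ar
  ∀₁   : ℕ → Form1 ar → Form1 ar
  ∃₁   : ℕ → Form1 ar → Form1 ar

data Form2 (ar : ℕ → ℕ) : Set where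
  ⊥₂   : Form2 ar
  SV   : (n : ℕ) → ℕ → Vec (Term ar) n → Form2 ar
  _⇒₂_ : Form2 ar → Form2 ar → Form2 ar
  _∧₂_ : Form2 ar → Form2 ar → Form2 ar
  _∨₂_ : Form2 ar → Form2 ar → Form2 ar
  ∀ᵢ   : ℕ → Form2 ar → Form2 ar
  ∃ᵢ   : ℕ → Form2 ar → Form2 ar
  ∀ₛ   : (n : ℕ) → ℕ → Form2 ar → Form2 ar
  ∃ₛ   : (n : ℕ) → ℕ → Form2 ar → Form2 ar

record Abs (ar : ℕ → ℕ) (n : ℕ) : Set where
  constructor abs
  field
    params : Vec ℕ n
    body   : Form2 ar

data Logic : Set where
  intu clas : Logic

remove : ℕ → List ℕ → List ℕ
remove x = L.filter (λ y → ¬? (y ≟ x))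

remove₂ : ℕ × ℕ → List (ℕ × ℕ) → List (ℕ × ℕ)
remove₂ p = L.filter (λ q → ¬? (≡-dec _≟_ _≟_ q p))

fresh : List ℕ → ℕ
fresh xs = suc (L.foldr _⊔_ 0 xs)

_[_↦_] : {A : Set} → (ℕ → A) → ℕ → A → ℕ → A
(σ [ x ↦ a ]) y = if y ≡ᵇ x then a else σ y

vars : (n : ℕ) → Vec ℕ n
vars n = V.tabulate toℕ

_∪_ : {A : Set} → (A → Set) → (A → Set) → A → Set
(P ∪ Q) a = P a ⊎ Q a

-- a first- or second-order variable χ
Var2 : Set
Var2 = ℕ ⊎ (ℕ × ℕ)

module _ {ar : ℕ → ℕ} where

  mutual
    tvars : Term ar → List ℕ
    tvars (var x)    = x ∷ []
    tvars (fun f ts) = tsvars ts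

    tsvars : ∀ {m} → Vec (Term ar) m → List ℕ
    tsvars []       = []
    tsvars (t ∷ ts) = tvars t ++ tsvars ts

  mutual
    tsub : (ℕ → Term ar) → Term ar → Term ar
    tsub σ (var x)    = σ x
    tsub σ (fun f ts) = fun f (tsubs σ ts)

    tsubs : ∀ {m} → (ℕ → Term ar) → Vec (Term ar) m → Vec (Term ar) m
    tsubs σ []       = []
    tsubs σ (t ∷ ts) = tsub σ t ∷ tsubs σ ts

  imgVars : (ℕ → Term ar) → List ℕ → List ℕ
  imgVars σ zs = L.concatMap (λ z → tvars (σ z)) zs

  fv1 : Form1 ar → List ℕ
  fv1 ⊥₁         = []
  fv1 (Ap n ts)  = tsvars ts
  fv1 (A ⇒₁ B)   = fv1 A ++ fv1 B
  fv1 (A ∧₁ B)   = fv1 A ++ fv1 B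
  fv1 (A ∨₁ B)   = fv1 A ++ fv1 B
  fv1 (∀₁ x A)   = remove x (fv1 A)
  fv1 (∃₁ x A)   = remove x (fv1 A)

  fvCtx1 : List (Form1 ar) → List ℕ
  fvCtx1 = L.concatMap fv1

  sub1 : (ℕ → Term ar) → Form1 ar → Form1 ar
  sub1 σ ⊥₁        = ⊥₁
  sub1 σ (Ap n ts) = Ap n (tsubs σ ts)
  sub1 σ (A ⇒₁ B)  = sub1 σ A ⇒₁ sub1 σ B
  sub1 σ (A ∧₁ B)  = sub1 σ A ∧₁ sub1 σ B
  sub1 σ (A ∨₁ B)  = sub1 σ A ∨₁ sub1 σ B
  sub1 σ (∀₁ x A)  = let y = fresh (imgVars σ (remove x (fv1 A)))
                     in ∀₁ y (sub1 (σ [ x ↦ var y ]) A)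
  sub1 σ (∃₁ x A)  = let y = fresh (imgVars σ (remove x (fv1 A)))
                     in ∃₁ y (sub1 (σ [ x ↦ var y ]) A)

  _[_≔₁_] : Form1 ar → ℕ → Term ar → Form1 ar
  A [ x ≔₁ t ] = sub1 (var [ x ↦ t ]) A

  ¬₁_ : Form1 ar → Form1 ar
  ¬₁ A = A ⇒₁ ⊥₁

  fv2ᵢ : Form2 ar → List ℕ
  fv2ᵢ ⊥₂          = []
  fv2ᵢ (SV n X ts) = tsvars ts
  fv2ᵢ (A ⇒₂ B)    = fv2ᵢ A ++ fv2ᵢ B
  fv2ᵢ (A ∧₂ B)    = fv2ᵢ A ++ fv2ᵢ B
  fv2ᵢ (A ∨₂ B)    = fv2ᵢ A ++ fv2ᵢ B
  fv2ᵢ (∀ᵢ x A)    = remove x (fv2ᵢ A)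
  fv2ᵢ (∃ᵢ x A)    = remove x (fv2ᵢ A)
  fv2ᵢ (∀ₛ n X A)  = fv2ᵢ A
  fv2ᵢ (∃ₛ n X A)  = fv2ᵢ A

  fv2ₛ : Form2 ar → List (ℕ × ℕ)
  fv2ₛ ⊥₂          = []
  fv2ₛ (SV n X ts) = (n , X) ∷ []
  fv2ₛ (A ⇒₂ B)    = fv2ₛ A ++ fv2ₛ B
  fv2ₛ (A ∧₂ B)    = fv2ₛ A ++ fv2ₛ B
  fv2ₛ (A ∨₂ B)    = fv2ₛ A ++ fv2ₛ B
  fv2ₛ (∀ᵢ x A)    = fv2ₛ A
  fv2ₛ (∃ᵢ x A)    = fv2ₛ A
  fv2ₛ (∀ₛ n X A)  = remove₂ (n , X) (fv2ₛ A)
  fv2ₛ (∃ₛ n X A)  = remove₂ (n , X) (fv2ₛ A)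

  fvCtx2ᵢ : List (Form2 ar) → List ℕ
  fvCtx2ᵢ = L.concatMap fv2ᵢ

  fvCtx2ₛ : List (Form2 ar) → List (ℕ × ℕ)
  fvCtx2ₛ = L.concatMap fv2ₛ

  absFvᵢ : ∀ {n} → Abs ar n → List ℕ
  absFvᵢ (abs xs G) = L.filter (λ y → ¬? (Any.any? (λ x → y ≟ x) (V.toList xs))) (fv2ᵢ G)

  absFvₛ : ∀ {n} → Abs ar n → List (ℕ × ℕ)
  absFvₛ (abs xs G) = fv2ₛ G

  sub2t : (ℕ → Term ar) → Form2 ar → Form2 ar
  sub2t σ ⊥₂          = ⊥₂
  sub2t σ (SV n X ts) = SV n X (tsubs σ ts)
  sub2t σ (A ⇒₂ B)    = sub2t σ A ⇒₂ sub2t σ B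
  sub2t σ (A ∧₂ B)    = sub2t σ A ∧₂ sub2t σ B
  sub2t σ (A ∨₂ B)    = sub2t σ A ∨₂ sub2t σ B
  sub2t σ (∀ᵢ x A)    = let y = fresh (imgVars σ (remove x (fv2ᵢ A)))
                        in ∀ᵢ y (sub2t (σ [ x ↦ var y ]) A)
  sub2t σ (∃ᵢ x A)    = let y = fresh (imgVars σ (remove x (fv2ᵢ A)))
                        in ∃ᵢ y (sub2t (σ [ x ↦ var y ]) A)
  sub2t σ (∀ₛ n X A)  = ∀ₛ n X (sub2t σ A)
  sub2t σ (∃ₛ n X A)  = ∃ₛ n X (sub2t σ A)

  bindAll : ∀ {m} → Vec ℕ m → Vec (Term ar) m → (ℕ → Term ar) → ℕ → Term ar
  bindAll []       []       σ = σ
  bindAll (x ∷ xs) (t ∷ ts) σ = bindAll xs ts (σ [ x ↦ t ])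

  instAbs : ∀ {n} → Abs ar n → Vec (Term ar) n → Form2 ar
  instAbs (abs xs G) ts = sub2t (bindAll xs ts var) G

  absVar : (n : ℕ) → ℕ → Abs ar n
  absVar n Y = abs (vars n) (SV n Y (V.map var (vars n)))

  _[_,_↦ₛ_] : ((n : ℕ) → ℕ → Abs ar n) → (n : ℕ) → ℕ → Abs ar n
              → (m : ℕ) → ℕ → Abs ar m
  (σ [ n , X ↦ₛ a ]) m Y with m ≟ n
  ... | yes refl = if Y ≡ᵇ X then a else σ m Y
  ... | no _     = σ m Y

  sub2 : (ℕ → Term ar) → ((n : ℕ) → ℕ → Abs ar n) → Form2 ar → Form2 ar
  sub2 σ τ ⊥₂          = ⊥₂
  sub2 σ τ (SV n X ts) = instAbs (τ n X) (tsubs σ ts)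
  sub2 σ τ (A ⇒₂ B)    = sub2 σ τ A ⇒₂ sub2 σ τ B
  sub2 σ τ (A ∧₂ B)    = sub2 σ τ A ∧₂ sub2 σ τ B
  sub2 σ τ (A ∨₂ B)    = sub2 σ τ A ∨₂ sub2 σ τ B
  sub2 σ τ (∀ᵢ x A)    = let y = fresh (imgVars σ (remove x (fv2ᵢ A))
                                     ++ L.concatMap (λ p → absFvᵢ (τ (proj₁ p) (proj₂ p))) (fv2ₛ A))
                         in ∀ᵢ y (sub2 (σ [ x ↦ var y ]) τ A)
  sub2 σ τ (∃ᵢ x A)    = let y = fresh (imgVars σ (remove x (fv2ᵢ A))
                                     ++ L.concatMap (λ p → absFvᵢ (τ (proj₁ p) (proj₂ p))) (fv2ₛ A))
                         in ∃ᵢ y (sub2 (σ [ x ↦ var y ]) τ A)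
  sub2 σ τ (∀ₛ n X A)  = let Y = fresh (L.concatMap (λ p → L.map proj₂ (absFvₛ (τ (proj₁ p) (proj₂ p))))
                                                     (remove₂ (n , X) (fv2ₛ A)))
                         in ∀ₛ n Y (sub2 σ (τ [ n , X ↦ₛ absVar n Y ]) A)
  sub2 σ τ (∃ₛ n X A)  = let Y = fresh (L.concatMap (λ p → L.map proj₂ (absFvₛ (τ (proj₁ p) (proj₂ p))))
                                                     (remove₂ (n , X) (fv2ₛ A)))
                         in ∃ₛ n Y (sub2 σ (τ [ n , X ↦ₛ absVar n Y ]) A)

  _[_≔ᵢ_] : Form2 ar → ℕ → Term ar → Form2 ar
  A [ x ≔ᵢ t ] = sub2 (var [ x ↦ t ]) absVar A

  _[_,_≔ₛ_] : Form2 ar → (n : ℕ) → ℕ → Abs ar n → Form2 ar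
  A [ n , X ≔ₛ a ] = sub2 var (absVar [ n , X ↦ₛ a ]) A

  ¬₂_ : Form2 ar → Form2 ar
  ¬₂ A = A ⇒₂ ⊥₂

  _⇔₂_ : Form2 ar → Form2 ar → Form2 ar
  A ⇔₂ B = (A ⇒₂ B) ∧₂ (B ⇒₂ A)

  data _⊢₁[_]_ : List (Form1 ar) → Logic → Form1 ar → Set where
    hyp  : ∀ {Δ k A} → A ∈ Δ → Δ ⊢₁[ k ] A
    ⊥E   : ∀ {Δ k A} → Δ ⊢₁[ k ] ⊥₁ → Δ ⊢₁[ k ] A
    raa  : ∀ {Δ A} → ((¬₁ A) ∷ Δ) ⊢₁[ clas ] ⊥₁ → Δ ⊢₁[ clas ] A
    ⇒I   : ∀ {Δ k A B} → (A ∷ Δ) ⊢₁[ k ] B → Δ ⊢₁[ k ] (A ⇒₁ B)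
    ⇒E   : ∀ {Δ k A B} → Δ ⊢₁[ k ] (A ⇒₁ B) → Δ ⊢₁[ k ] A → Δ ⊢₁[ k ] B
    ∧I   : ∀ {Δ k A B} → Δ ⊢₁[ k ] A → Δ ⊢₁[ k ] B → Δ ⊢₁[ k ] (A ∧₁ B)
    ∧E₁  : ∀ {Δ k A B} → Δ ⊢₁[ k ] (A ∧₁ B) → Δ ⊢₁[ k ] A
    ∧E₂  : ∀ {Δ k A B} → Δ ⊢₁[ k ] (A ∧₁ B) → Δ ⊢₁[ k ] B
    ∨I₁  : ∀ {Δ k A B} → Δ ⊢₁[ k ] A → Δ ⊢₁[ k ] (A ∨₁ B)
    ∨I₂  : ∀ {Δ k A B} → Δ ⊢₁[ k ] B → Δ ⊢₁[ k ] (A ∨₁ B)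
    ∨E   : ∀ {Δ k A B C} → Δ ⊢₁[ k ] (A ∨₁ B) → (A ∷ Δ) ⊢₁[ k ] C → (B ∷ Δ) ⊢₁[ k ] C
           → Δ ⊢₁[ k ] C
    ∀I   : ∀ {Δ k x A} (y : ℕ) → y ∉ fvCtx1 Δ → y ∉ fv1 (∀₁ x A)
           → Δ ⊢₁[ k ] (A [ x ≔₁ var y ]) → Δ ⊢₁[ k ] (∀₁ x A)
    ∀E   : ∀ {Δ k x A} (t : Term ar) → Δ ⊢₁[ k ] (∀₁ x A) → Δ ⊢₁[ k ] (A [ x ≔₁ t ])
    ∃I   : ∀ {Δ k x A} (t : Term ar) → Δ ⊢₁[ k ] (A [ x ≔₁ t ]) → Δ ⊢₁[ k ] (∃₁ x A)
    ∃E   : ∀ {Δ k x A C} (y : ℕ) → y ∉ fvCtx1 Δ → y ∉ fv1 (∃₁ x A) → y ∉ fv1 C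
           → Δ ⊢₁[ k ] (∃₁ x A) → ((A [ x ≔₁ var y ]) ∷ Δ) ⊢₁[ k ] C → Δ ⊢₁[ k ] C

  data _⊢₂[_]_ : List (Form2 ar) → Logic → Form2 ar → Set where
    hyp  : ∀ {Δ k A} → A ∈ Δ → Δ ⊢₂[ k ] A
    ⊥E   : ∀ {Δ k A} → Δ ⊢₂[ k ] ⊥₂ → Δ ⊢₂[ k ] A
    raa  : ∀ {Δ A} → ((¬₂ A) ∷ Δ) ⊢₂[ clas ] ⊥₂ → Δ ⊢₂[ clas ] A
    ⇒I   : ∀ {Δ k A B} → (A ∷ Δ) ⊢₂[ k ] B → Δ ⊢₂[ k ] (A ⇒₂ B)
    ⇒E   : ∀ {Δ k A B} → Δ ⊢₂[ k ] (A ⇒₂ B) → Δ ⊢₂[ k ] A → Δ ⊢₂[ k ] B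
    ∧I   : ∀ {Δ k A B} → Δ ⊢₂[ k ] A → Δ ⊢₂[ k ] B → Δ ⊢₂[ k ] (A ∧₂ B)
    ∧E₁  : ∀ {Δ k A B} → Δ ⊢₂[ k ] (A ∧₂ B) → Δ ⊢₂[ k ] A
    ∧E₂  : ∀ {Δ k A B} → Δ ⊢₂[ k ] (A ∧₂ B) → Δ ⊢₂[ k ] B
    ∨I₁  : ∀ {Δ k A B} → Δ ⊢₂[ k ] A → Δ ⊢₂[ k ] (A ∨₂ B)
    ∨I₂  : ∀ {Δ k A B} → Δ ⊢₂[ k ] B → Δ ⊢₂[ k ] (A ∨₂ B)
    ∨E   : ∀ {Δ k A B C} → Δ ⊢₂[ k ] (A ∨₂ B) → (A ∷ Δ) ⊢₂[ k ] C → (B ∷ Δ) ⊢₂[ k ] C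
           → Δ ⊢₂[ k ] C
    ∀I   : ∀ {Δ k x A} (y : ℕ) → y ∉ fvCtx2ᵢ Δ → y ∉ fv2ᵢ (∀ᵢ x A)
           → Δ ⊢₂[ k ] (A [ x ≔ᵢ var y ]) → Δ ⊢₂[ k ] (∀ᵢ x A)
    ∀E   : ∀ {Δ k x A} (t : Term ar) → Δ ⊢₂[ k ] (∀ᵢ x A) → Δ ⊢₂[ k ] (A [ x ≔ᵢ t ])
    ∃I   : ∀ {Δ k x A} (t : Term ar) → Δ ⊢₂[ k ] (A [ x ≔ᵢ t ]) → Δ ⊢₂[ k ] (∃ᵢ x A)
    ∃E   : ∀ {Δ k x A C} (y : ℕ) → y ∉ fvCtx2ᵢ Δ → y ∉ fv2ᵢ (∃ᵢ x A) → y ∉ fv2ᵢ C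
           → Δ ⊢₂[ k ] (∃ᵢ x A) → ((A [ x ≔ᵢ var y ]) ∷ Δ) ⊢₂[ k ] C → Δ ⊢₂[ k ] C
    ∀ₛI  : ∀ {Δ k n X A} (Y : ℕ) → (n , Y) ∉ fvCtx2ₛ Δ → (n , Y) ∉ fv2ₛ (∀ₛ n X A)
           → Δ ⊢₂[ k ] (A [ n , X ≔ₛ absVar n Y ]) → Δ ⊢₂[ k ] (∀ₛ n X A)
    ∀ₛE  : ∀ {Δ k n X A} (a : Abs ar n) → Δ ⊢₂[ k ] (∀ₛ n X A) → Δ ⊢₂[ k ] (A [ n , X ≔ₛ a ])
    ∃ₛI  : ∀ {Δ k n X A} (a : Abs ar n) → Δ ⊢₂[ k ] (A [ n , X ≔ₛ a ]) → Δ ⊢₂[ k ] (∃ₛ n X A)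
    ∃ₛE  : ∀ {Δ k n X A C} (Y : ℕ) → (n , Y) ∉ fvCtx2ₛ Δ → (n , Y) ∉ fv2ₛ (∃ₛ n X A)
           → (n , Y) ∉ fv2ₛ C
           → Δ ⊢₂[ k ] (∃ₛ n X A) → ((A [ n , X ≔ₛ absVar n Y ]) ∷ Δ) ⊢₂[ k ] C → Δ ⊢₂[ k ] C

  -- derivability from a (possibly infinite) set of hypotheses:
  -- Γ ⊢ A iff A is derivable from finitely many members of Γ

  _⊩₁[_]_ : (Form1 ar → Set) → Logic → Form1 ar → Set
  Γ ⊩₁[ k ] A = Σ (List (Form1 ar)) λ Δ → All Γ Δ × (Δ ⊢₁[ k ] A)

  _⊩₂[_]_ : (Form2 ar → Set) → Logic → Form2 ar → Set
  Γ ⊩₂[ k ] A = Σ (List (Form2 ar)) λ Δ → All Γ Δ × (Δ ⊢₂[ k ] A)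

  -- the coding F ↦ F*, relative to renamings ρ₁ (first-order variables)
  -- and ρ₂ (second-order variables); bound variables are sent to a
  -- variable not free in the coded formula.

  upd₂ : ((n : ℕ) → ℕ → ℕ) → ℕ → ℕ → ℕ → (m : ℕ) → ℕ → ℕ
  upd₂ ρ n X y m Y = if (m ≡ᵇ n) ∧ᵇ (Y ≡ᵇ X) then y else ρ m Y

  codedFv : (ℕ → ℕ) → ((n : ℕ) → ℕ → ℕ) → Form2 ar → List ℕ
  codedFv ρ₁ ρ₂ B = L.map ρ₁ (fv2ᵢ B) ++ L.map (λ p → ρ₂ (proj₁ p) (proj₂ p)) (fv2ₛ B)

  code : (ℕ → ℕ) → ((n : ℕ) → ℕ → ℕ) → Form2 ar → Form1 ar
  code ρ₁ ρ₂ ⊥₂          = ⊥₁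
  code ρ₁ ρ₂ (SV n X ts) = Ap n (var (ρ₂ n X) ∷ tsubs (λ z → var (ρ₁ z)) ts)
  code ρ₁ ρ₂ (A ⇒₂ B)    = code ρ₁ ρ₂ A ⇒₁ code ρ₁ ρ₂ B
  code ρ₁ ρ₂ (A ∧₂ B)    = code ρ₁ ρ₂ A ∧₁ code ρ₁ ρ₂ B
  code ρ₁ ρ₂ (A ∨₂ B)    = code ρ₁ ρ₂ A ∨₁ code ρ₁ ρ₂ B
  code ρ₁ ρ₂ (∀ᵢ x A)    = let y = fresh (codedFv ρ₁ ρ₂ (∀ᵢ x A))
                           in ∀₁ y (code (ρ₁ [ x ↦ y ]) ρ₂ A)
  code ρ₁ ρ₂ (∃ᵢ x A)    = let y = fresh (codedFv ρ₁ ρ₂ (∃ᵢ x A))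
                           in ∃₁ y (code (ρ₁ [ x ↦ y ]) ρ₂ A)
  code ρ₁ ρ₂ (∀ₛ n X A)  = let y = fresh (codedFv ρ₁ ρ₂ (∀ₛ n X A))
                           in ∀₁ y (code ρ₁ (upd₂ ρ₂ n X y) A)
  code ρ₁ ρ₂ (∃ₛ n X A)  = let y = fresh (codedFv ρ₁ ρ₂ (∃ₛ n X A))
                           in ∃₁ y (code ρ₁ (upd₂ ρ₂ n X y) A)

  _*⟨_⟩ : Form2 ar → ((n : ℕ) → ℕ ⤖ ℕ) → Form1 ar
  F *⟨ φ ⟩ = code (λ x → x) (λ n → Bijection.to (φ n)) F

  _*ˢ⟨_⟩ : (Form2 ar → Set) → ((n : ℕ) → ℕ ⤖ ℕ) → Form1 ar → Set
  (Γ *ˢ⟨ φ ⟩) F' = Σ (Form2 ar) λ F → Γ F × (F' ≡ F *⟨ φ ⟩)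

  closeAll : List Var2 → Form2 ar → Form2 ar
  closeAll []               F = F
  closeAll (inj₁ x ∷ χs)    F = ∀ᵢ x (closeAll χs F)
  closeAll (inj₂ (n , X) ∷ χs) F = ∀ₛ n X (closeAll χs F)

  allᵢ : List ℕ → Form2 ar → Form2 ar
  allᵢ []       F = F
  allᵢ (x ∷ xs) F = ∀ᵢ x (allᵢ xs F)

  Closed2 : Form2 ar → Set
  Closed2 F = (fv2ᵢ F ≡ []) × (fv2ₛ F ≡ [])

  SC2 : Form2 ar → Set
  SC2 F = Σ (List Var2) λ χs → Σ ℕ λ n → Σ ℕ λ X → Σ (Vec ℕ n) λ xs → Σ (Form2 ar) λ G →
            (F ≡ closeAll χs (∃ₛ n X (allᵢ (V.toList xs) (G ⇔₂ SV n X (V.map var xs)))))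
          × Closed2 F
          × (∀ z → z ∈ fv2ᵢ G → (z ∈ V.toList xs) ⊎ (inj₁ z ∈ χs))
          × (∀ p → p ∈ fv2ₛ G → inj₂ p ∈ χs)
          × ((n , X) ∉ fv2ₛ G)

  SC1 : ((n : ℕ) → ℕ ⤖ ℕ) → Form1 ar → Set
  SC1 φ = SC2 *ˢ⟨ φ ⟩

-- A second-order variable Xⁿ is coded by the first-order variable φₙ(Xⁿ), so a derivation can be
-- translated rule by rule. The only rules that do not translate verbatim are second-order
-- ∀-elimination and ∃-introduction at an abstraction λx̄.G: there one opens the comprehension
-- instance for G, a member of SC₁, which supplies a variable b with ∀x̄ (G* ↔ Apₙ(b, x̄)), and
-- uses b as the first-order witness. The translated instance (A[Xⁿ := λx̄.G])* and the instance
-- of A* at b are then interderivable, by induction on A.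
-- The rest is bookkeeping about bound names: first-order formulas are compared through their
-- locally nameless images, and formulas with equal images are interderivable.

module Submission where

open import Defs
open import Data.Bool using (T; true; false; if_then_else_) renaming (_∧_ to _∧ᵇ_)
open import Data.Empty using (⊥-elim)
open import Data.Fin as F using (Fin)
import Data.Fin.Properties as FP
open import Data.List as L using (List; []; _∷_; _++_)
open import Data.List.Membership.Propositional using (_∈_; _∉_)
open import Data.List.Membership.Propositional.Properties
open import Data.List.Relation.Binary.Subset.Propositional using (_⊆_)
import Data.List.Relation.Unary.All as All
open import Data.List.Relation.Unary.Any as Any using (here; there)
open import Data.Nat using (ℕ; zero; suc; _≡ᵇ_; _≟_; _⊔_; _≤_)
open import Data.Nat.Properties using (≡ᵇ⇒≡; ≤-refl; ≤-trans; m≤m⊔n; m≤n⊔m; n≤1+n; <-irrefl)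
open import Data.Product using (Σ; _×_; _,_; proj₁; proj₂)
open import Data.Product.Properties using (≡-dec)
open import Data.Sum using (_⊎_; inj₁; inj₂)
import Data.Sum.Properties as Sum
open import Data.Unit using (⊤; tt)
open import Data.Vec as V using (Vec; []; _∷_)
open import Function using (_∘_)
open import Function.Bundles using (_⤖_; Bijection)
open import Relation.Nullary using (yes; no; ¬?)
open import Relation.Binary.PropositionalEquality using (_≡_; _≢_; refl; sym; trans; cong; cong₂; subst)

≡ᵇ-refl : ∀ n → (n ≡ᵇ n) ≡ true
≡ᵇ-refl zero    = refl
≡ᵇ-refl (suc n) = ≡ᵇ-refl n

≡ᵇ-false : ∀ {m n} → m ≢ n → (m ≡ᵇ n) ≡ false
≡ᵇ-false {m} {n} m≢n with m ≡ᵇ n in eq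
... | true  = ⊥-elim (m≢n (≡ᵇ⇒≡ m n (subst T (sym eq) tt)))
... | false = refl

module _ {A : Set} where

  ↦-same : ∀ (σ : ℕ → A) x a → (σ [ x ↦ a ]) x ≡ a
  ↦-same σ x a rewrite ≡ᵇ-refl x = refl

  ↦-other : ∀ (σ : ℕ → A) x a {z} → z ≢ x → (σ [ x ↦ a ]) z ≡ σ z
  ↦-other σ x a z≢x rewrite ≡ᵇ-false z≢x = refl

  _[_,_↦₂_] : (ℕ → ℕ → A) → ℕ → ℕ → A → ℕ → ℕ → A
  (ρ [ n , X ↦₂ a ]) m Y = if (m ≡ᵇ n) ∧ᵇ (Y ≡ᵇ X) then a else ρ m Y

  ↦₂-same : ∀ (ρ : ℕ → ℕ → A) n X a → (ρ [ n , X ↦₂ a ]) n X ≡ a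
  ↦₂-same ρ n X a rewrite ≡ᵇ-refl n | ≡ᵇ-refl X = refl

  ↦₂-other : ∀ (ρ : ℕ → ℕ → A) n X a {m Y} → (m , Y) ≢ (n , X) → (ρ [ n , X ↦₂ a ]) m Y ≡ ρ m Y
  ↦₂-other ρ n X a {m} {Y} ne with m ≟ n | Y ≟ X
  ... | yes refl | yes refl = ⊥-elim (ne refl)
  ... | yes refl | no Y≢X rewrite ≡ᵇ-refl m | ≡ᵇ-false Y≢X = refl
  ... | no m≢n   | _      rewrite ≡ᵇ-false m≢n = refl

  ↦-agree : ∀ (σ f : ℕ → A) x z → σ z ≡ f z → (σ [ x ↦ f x ]) z ≡ f z
  ↦-agree σ f x z e with z ≟ x
  ... | yes refl = ↦-same σ z (f z)
  ... | no z≢x   rewrite ↦-other σ x (f x) z≢x = e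

  ↦₂-agree : ∀ (ρ f : ℕ → ℕ → A) n X m Y → ρ m Y ≡ f m Y → (ρ [ n , X ↦₂ f n X ]) m Y ≡ f m Y
  ↦₂-agree ρ f n X m Y e with ≡-dec _≟_ _≟_ (m , Y) (n , X)
  ... | yes refl = ↦₂-same ρ m Y (f m Y)
  ... | no ne    rewrite ↦₂-other ρ n X (f n X) ne = e

module _ {A B C : Set} (g : A → C) (h : B → C) where

  ↦-pointwise : ∀ (σ : ℕ → A) (τ : ℕ → B) x a b z → g a ≡ h b → (z ≢ x → g (σ z) ≡ h (τ z))
                → g ((σ [ x ↦ a ]) z) ≡ h ((τ [ x ↦ b ]) z)
  ↦-pointwise σ τ x a b z same other with z ≟ x
  ... | yes refl rewrite ↦-same σ x a | ↦-same τ x b = same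
  ... | no z≢x   rewrite ↦-other σ x a z≢x | ↦-other τ x b z≢x = other z≢x

  ↦₂-pointwise : ∀ (σ : ℕ → ℕ → A) (τ : ℕ → ℕ → B) n X a b m Y → g a ≡ h b
                 → ((m , Y) ≢ (n , X) → g (σ m Y) ≡ h (τ m Y))
                 → g ((σ [ n , X ↦₂ a ]) m Y) ≡ h ((τ [ n , X ↦₂ b ]) m Y)
  ↦₂-pointwise σ τ n X a b m Y same other with ≡-dec _≟_ _≟_ (m , Y) (n , X)
  ... | yes refl rewrite ↦₂-same σ n X a | ↦₂-same τ n X b = same
  ... | no ne    rewrite ↦₂-other σ n X a ne | ↦₂-other τ n X b ne = other ne

≤-foldr⊔ : ∀ {x} xs → x ∈ xs → x ≤ L.foldr _⊔_ 0 xs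
≤-foldr⊔ (y ∷ xs) (here refl) = m≤m⊔n y _
≤-foldr⊔ (y ∷ xs) (there x∈xs) = ≤-trans (≤-foldr⊔ xs x∈xs) (m≤n⊔m y _)

fresh-∉ : ∀ xs → fresh xs ∉ xs
fresh-∉ xs p = <-irrefl refl (≤-foldr⊔ xs p)

module _ {A : Set} {x : A} where

  ∉-++⁻ˡ : ∀ {xs ys} → x ∉ xs ++ ys → x ∉ xs
  ∉-++⁻ˡ x∉ p = x∉ (∈-++⁺ˡ p)

  ∉-++⁻ʳ : ∀ xs {ys} → x ∉ xs ++ ys → x ∉ ys
  ∉-++⁻ʳ xs x∉ p = x∉ (∈-++⁺ʳ xs p)

∈-concatMap⁺′ : ∀ {A B : Set} {x : A} {y : B} (f : A → List B) {xs} → x ∈ xs → y ∈ f x → y ∈ L.concatMap f xs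
∈-concatMap⁺′ f x∈xs y∈fx = ∈-concatMap⁺ f (Any.map (λ { refl → y∈fx }) x∈xs)

∈-remove⁺ : ∀ {z x xs} → z ∈ xs → z ≢ x → z ∈ remove x xs
∈-remove⁺ {x = x} = ∈-filter⁺ (λ y → ¬? (y ≟ x))

∈-remove⁻ : ∀ {z x} xs → z ∈ remove x xs → z ∈ xs × z ≢ x
∈-remove⁻ {x = x} xs = ∈-filter⁻ (λ y → ¬? (y ≟ x))

∈-remove₂⁺ : ∀ {p q xs} → p ∈ xs → p ≢ q → p ∈ remove₂ q xs
∈-remove₂⁺ {q = q} = ∈-filter⁺ (λ r → ¬? (≡-dec _≟_ _≟_ r q))

∈-remove₂⁻ : ∀ {p q} xs → p ∈ remove₂ q xs → p ∈ xs × p ≢ q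
∈-remove₂⁻ {q = q} xs = ∈-filter⁻ (λ r → ¬? (≡-dec _≟_ _≟_ r q))

-- locally nameless syntax: bound variables are de Bruijn indices, free ones are names
data NTerm (ar : ℕ → ℕ) : Set where
  bound : ℕ → NTerm ar
  free  : ℕ → NTerm ar
  fun   : (f : ℕ) → Vec (NTerm ar) (ar f) → NTerm ar

data NForm (ar : ℕ → ℕ) : Set where
  ⊥ₙ   : NForm ar
  Apₙ  : (n : ℕ) → Vec (NTerm ar) (suc n) → NForm ar
  _⇒ₙ_ : NForm ar → NForm ar → NForm ar
  _∧ₙ_ : NForm ar → NForm ar → NForm ar
  _∨ₙ_ : NForm ar → NForm ar → NForm ar
  ∀ₙ   : NForm ar → NForm ar
  ∃ₙ   : NForm ar → NForm ar

Distinct : ∀ {m} → Vec ℕ m → Set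
Distinct []       = ⊤
Distinct (x ∷ xs) = x ∉ V.toList xs × Distinct xs

∈-toList-tabulate⁻ : ∀ {m} (f : Fin m → ℕ) {x} → x ∈ V.toList (V.tabulate f) → Σ (Fin m) λ i → x ≡ f i
∈-toList-tabulate⁻ {suc m} f (here e) = F.zero , e
∈-toList-tabulate⁻ {suc m} f (there p) with ∈-toList-tabulate⁻ (λ i → f (F.suc i)) p
... | i , e = F.suc i , e

tabulate-distinct : ∀ {m} (f : Fin m → ℕ) → (∀ {i j} → f i ≡ f j → i ≡ j) → Distinct (V.tabulate f)
tabulate-distinct {zero}  f inj = tt
tabulate-distinct {suc m} f inj =
  (λ p → let i , e = ∈-toList-tabulate⁻ (λ i → f (F.suc i)) p in zero≢suc (inj e)) ,
  tabulate-distinct (λ i → f (F.suc i)) (λ e → FP.suc-injective (inj e))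
  where zero≢suc : ∀ {i : Fin m} → F.zero ≢ F.suc i
        zero≢suc ()

vars-distinct : ∀ n → Distinct (vars n)
vars-distinct n = tabulate-distinct F.toℕ FP.toℕ-injective

upFrom : ℕ → (n : ℕ) → Vec ℕ n
upFrom k zero    = []
upFrom k (suc n) = k ∷ upFrom (suc k) n

upFrom-≥ : ∀ k n {x} → x ∈ V.toList (upFrom k n) → k ≤ x
upFrom-≥ k (suc n) (here refl) = ≤-refl
upFrom-≥ k (suc n) (there p)   = ≤-trans (n≤1+n k) (upFrom-≥ (suc k) n p)

upFrom-distinct : ∀ k n → Distinct (upFrom k n)
upFrom-distinct k zero    = tt
upFrom-distinct k (suc n) = (λ p → <-irrefl refl (upFrom-≥ (suc k) n p)) , upFrom-distinct (suc k) n

module _ {ar : ℕ → ℕ} where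

  -- Locally nameless images

  mutual
    nsub : (ℕ → NTerm ar) → (ℕ → NTerm ar) → NTerm ar → NTerm ar
    nsub b f (bound i)  = b i
    nsub b f (free x)   = f x
    nsub b f (fun g ls) = fun g (nsubs b f ls)

    nsubs : ∀ {m} → (ℕ → NTerm ar) → (ℕ → NTerm ar) → Vec (NTerm ar) m → Vec (NTerm ar) m
    nsubs b f []       = []
    nsubs b f (l ∷ ls) = nsub b f l ∷ nsubs b f ls

  shift : NTerm ar → NTerm ar
  shift = nsub (λ i → bound (suc i)) free

  shift₁ : (ℕ → NTerm ar) → ℕ → NTerm ar
  shift₁ e z = shift (e z)

  shift₂ : (ℕ → ℕ → NTerm ar) → ℕ → ℕ → NTerm ar
  shift₂ e m Y = shift (e m Y)

  liftᵇ : (ℕ → NTerm ar) → ℕ → NTerm ar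
  liftᵇ b zero    = bound 0
  liftᵇ b (suc i) = shift (b i)

  nsubF : (ℕ → NTerm ar) → (ℕ → NTerm ar) → NForm ar → NForm ar
  nsubF b f ⊥ₙ         = ⊥ₙ
  nsubF b f (Apₙ n ls) = Apₙ n (nsubs b f ls)
  nsubF b f (P ⇒ₙ Q)   = nsubF b f P ⇒ₙ nsubF b f Q
  nsubF b f (P ∧ₙ Q)   = nsubF b f P ∧ₙ nsubF b f Q
  nsubF b f (P ∨ₙ Q)   = nsubF b f P ∨ₙ nsubF b f Q
  nsubF b f (∀ₙ P)     = ∀ₙ (nsubF (liftᵇ b) (shift₁ f) P)
  nsubF b f (∃ₙ P)     = ∃ₙ (nsubF (liftᵇ b) (shift₁ f) P)

  openWith : NTerm ar → ℕ → NTerm ar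
  openWith u zero    = u
  openWith u (suc i) = bound i

  mutual
    nsub-shift : ∀ b f l → nsub (liftᵇ b) (shift₁ f) (shift l) ≡ shift (nsub b f l)
    nsub-shift b f (bound i)  = refl
    nsub-shift b f (free x)   = refl
    nsub-shift b f (fun g ls) = cong (fun g) (nsubs-shift b f ls)

    nsubs-shift : ∀ {m} b f (ls : Vec (NTerm ar) m)
                  → nsubs (liftᵇ b) (shift₁ f) (nsubs (λ i → bound (suc i)) free ls)
                    ≡ nsubs (λ i → bound (suc i)) free (nsubs b f ls)
    nsubs-shift b f []       = refl
    nsubs-shift b f (l ∷ ls) = cong₂ _∷_ (nsub-shift b f l) (nsubs-shift b f ls)

  mutual
    openWith-shift : ∀ u l → nsub (openWith u) free (shift l) ≡ l
    openWith-shift u (bound i)  = refl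
    openWith-shift u (free x)   = refl
    openWith-shift u (fun g ls) = cong (fun g) (openWith-shifts u ls)

    openWith-shifts : ∀ {m} u (ls : Vec (NTerm ar) m)
                      → nsubs (openWith u) free (nsubs (λ i → bound (suc i)) free ls) ≡ ls
    openWith-shifts u []       = refl
    openWith-shifts u (l ∷ ls) = cong₂ _∷_ (openWith-shift u l) (openWith-shifts u ls)

  mutual
    nTerm : (ℕ → NTerm ar) → Term ar → NTerm ar
    nTerm e (var x)    = e x
    nTerm e (fun f ts) = fun f (nTerms e ts)

    nTerms : ∀ {m} → (ℕ → NTerm ar) → Vec (Term ar) m → Vec (NTerm ar) m
    nTerms e []       = []
    nTerms e (t ∷ ts) = nTerm e t ∷ nTerms e ts

  mutual
    nsub-nTerm : ∀ b f e t → nsub b f (nTerm e t) ≡ nTerm (λ z → nsub b f (e z)) t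
    nsub-nTerm b f e (var x)    = refl
    nsub-nTerm b f e (fun g ts) = cong (fun g) (nsubs-nTerms b f e ts)

    nsubs-nTerms : ∀ {m} b f e (ts : Vec (Term ar) m) → nsubs b f (nTerms e ts) ≡ nTerms (λ z → nsub b f (e z)) ts
    nsubs-nTerms b f e []       = refl
    nsubs-nTerms b f e (t ∷ ts) = cong₂ _∷_ (nsub-nTerm b f e t) (nsubs-nTerms b f e ts)

  shift-nTerm : ∀ e t → shift (nTerm e t) ≡ nTerm (shift₁ e) t
  shift-nTerm = nsub-nTerm (λ i → bound (suc i)) free

  mutual
    nTerm-tsub : ∀ e σ t → nTerm e (tsub σ t) ≡ nTerm (λ z → nTerm e (σ z)) t
    nTerm-tsub e σ (var x)    = refl
    nTerm-tsub e σ (fun g ts) = cong (fun g) (nTerms-tsubs e σ ts)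

    nTerms-tsubs : ∀ {m} e σ (ts : Vec (Term ar) m) → nTerms e (tsubs σ ts) ≡ nTerms (λ z → nTerm e (σ z)) ts
    nTerms-tsubs e σ []       = refl
    nTerms-tsubs e σ (t ∷ ts) = cong₂ _∷_ (nTerm-tsub e σ t) (nTerms-tsubs e σ ts)

  mutual
    nTerm-ext : ∀ e e′ t → (∀ z → z ∈ tvars t → e z ≡ e′ z) → nTerm e t ≡ nTerm e′ t
    nTerm-ext e e′ (var x)    h = h x (here refl)
    nTerm-ext e e′ (fun g ts) h = cong (fun g) (nTerms-ext e e′ ts h)

    nTerms-ext : ∀ {m} e e′ (ts : Vec (Term ar) m) → (∀ z → z ∈ tsvars ts → e z ≡ e′ z) → nTerms e ts ≡ nTerms e′ ts
    nTerms-ext e e′ []       h = refl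
    nTerms-ext e e′ (t ∷ ts) h = cong₂ _∷_ (nTerm-ext e e′ t (λ z p → h z (∈-++⁺ˡ p)))
                                           (nTerms-ext e e′ ts (λ z p → h z (∈-++⁺ʳ (tvars t) p)))

  mutual
    tsub-ext : ∀ σ σ′ t → (∀ z → z ∈ tvars t → σ z ≡ σ′ z) → tsub σ t ≡ tsub σ′ t
    tsub-ext σ σ′ (var x)    h = h x (here refl)
    tsub-ext σ σ′ (fun g ts) h = cong (fun g) (tsubs-ext σ σ′ ts h)

    tsubs-ext : ∀ {m} σ σ′ (ts : Vec (Term ar) m) → (∀ z → z ∈ tsvars ts → σ z ≡ σ′ z) → tsubs σ ts ≡ tsubs σ′ ts
    tsubs-ext σ σ′ []       h = refl
    tsubs-ext σ σ′ (t ∷ ts) h = cong₂ _∷_ (tsub-ext σ σ′ t (λ z p → h z (∈-++⁺ˡ p)))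
                                          (tsubs-ext σ σ′ ts (λ z p → h z (∈-++⁺ʳ (tvars t) p)))

  mutual
    tsub-tsub : ∀ σ σ′ t → tsub σ (tsub σ′ t) ≡ tsub (λ z → tsub σ (σ′ z)) t
    tsub-tsub σ σ′ (var x)    = refl
    tsub-tsub σ σ′ (fun g ts) = cong (fun g) (tsubs-tsubs σ σ′ ts)

    tsubs-tsubs : ∀ {m} σ σ′ (ts : Vec (Term ar) m) → tsubs σ (tsubs σ′ ts) ≡ tsubs (λ z → tsub σ (σ′ z)) ts
    tsubs-tsubs σ σ′ []       = refl
    tsubs-tsubs σ σ′ (t ∷ ts) = cong₂ _∷_ (tsub-tsub σ σ′ t) (tsubs-tsubs σ σ′ ts)

  nForm : (ℕ → NTerm ar) → Form1 ar → NForm ar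
  nForm e ⊥₁        = ⊥ₙ
  nForm e (Ap n ts) = Apₙ n (nTerms e ts)
  nForm e (A ⇒₁ B)  = nForm e A ⇒ₙ nForm e B
  nForm e (A ∧₁ B)  = nForm e A ∧ₙ nForm e B
  nForm e (A ∨₁ B)  = nForm e A ∨ₙ nForm e B
  nForm e (∀₁ x A)  = ∀ₙ (nForm (shift₁ e [ x ↦ bound 0 ]) A)
  nForm e (∃₁ x A)  = ∃ₙ (nForm (shift₁ e [ x ↦ bound 0 ]) A)

  -- the nameless image of  code ρ₁ ρ₂ A  (nForm-code), computed without choosing bound names
  nCode : (ℕ → NTerm ar) → (ℕ → ℕ → NTerm ar) → Form2 ar → NForm ar
  nCode E₁ E₂ ⊥₂          = ⊥ₙ
  nCode E₁ E₂ (SV n X ts) = Apₙ n (E₂ n X ∷ nTerms E₁ ts)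
  nCode E₁ E₂ (A ⇒₂ B)    = nCode E₁ E₂ A ⇒ₙ nCode E₁ E₂ B
  nCode E₁ E₂ (A ∧₂ B)    = nCode E₁ E₂ A ∧ₙ nCode E₁ E₂ B
  nCode E₁ E₂ (A ∨₂ B)    = nCode E₁ E₂ A ∨ₙ nCode E₁ E₂ B
  nCode E₁ E₂ (∀ᵢ x A)    = ∀ₙ (nCode (shift₁ E₁ [ x ↦ bound 0 ]) (shift₂ E₂) A)
  nCode E₁ E₂ (∃ᵢ x A)    = ∃ₙ (nCode (shift₁ E₁ [ x ↦ bound 0 ]) (shift₂ E₂) A)
  nCode E₁ E₂ (∀ₛ n X A)  = ∀ₙ (nCode (shift₁ E₁) (shift₂ E₂ [ n , X ↦₂ bound 0 ]) A)
  nCode E₁ E₂ (∃ₛ n X A)  = ∃ₙ (nCode (shift₁ E₁) (shift₂ E₂ [ n , X ↦₂ bound 0 ]) A)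

  image : (ℕ → Term ar) → (ℕ → ℕ → ℕ) → Form2 ar → NForm ar
  image ς r = nCode (λ z → nTerm free (ς z)) (λ m Y → free (r m Y))

  binder-ext : ∀ (e e′ : ℕ → NTerm ar) x {zs} → (∀ z → z ∈ remove x zs → e z ≡ e′ z)
               → ∀ z → z ∈ zs → (shift₁ e [ x ↦ bound 0 ]) z ≡ (shift₁ e′ [ x ↦ bound 0 ]) z
  binder-ext e e′ x h z p =
    ↦-pointwise (λ v → v) (λ v → v) (shift₁ e) (shift₁ e′) x _ _ z refl (λ z≢x → cong shift (h z (∈-remove⁺ p z≢x)))

  binder₂-ext : ∀ (E E′ : ℕ → ℕ → NTerm ar) n X {ps} → (∀ m Y → (m , Y) ∈ remove₂ (n , X) ps → E m Y ≡ E′ m Y)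
                → ∀ m Y → (m , Y) ∈ ps → (shift₂ E [ n , X ↦₂ bound 0 ]) m Y ≡ (shift₂ E′ [ n , X ↦₂ bound 0 ]) m Y
  binder₂-ext E E′ n X h m Y p =
    ↦₂-pointwise (λ v → v) (λ v → v) (shift₂ E) (shift₂ E′) n X _ _ m Y refl (λ ne → cong shift (h m Y (∈-remove₂⁺ p ne)))

  nForm-ext : ∀ e e′ A → (∀ z → z ∈ fv1 A → e z ≡ e′ z) → nForm e A ≡ nForm e′ A
  nForm-ext e e′ ⊥₁        h = refl
  nForm-ext e e′ (Ap n ts) h = cong (Apₙ n) (nTerms-ext e e′ ts h)
  nForm-ext e e′ (A ⇒₁ B)  h = cong₂ _⇒ₙ_ (nForm-ext e e′ A (λ z p → h z (∈-++⁺ˡ p)))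
                                          (nForm-ext e e′ B (λ z p → h z (∈-++⁺ʳ (fv1 A) p)))
  nForm-ext e e′ (A ∧₁ B)  h = cong₂ _∧ₙ_ (nForm-ext e e′ A (λ z p → h z (∈-++⁺ˡ p)))
                                          (nForm-ext e e′ B (λ z p → h z (∈-++⁺ʳ (fv1 A) p)))
  nForm-ext e e′ (A ∨₁ B)  h = cong₂ _∨ₙ_ (nForm-ext e e′ A (λ z p → h z (∈-++⁺ˡ p)))
                                          (nForm-ext e e′ B (λ z p → h z (∈-++⁺ʳ (fv1 A) p)))
  nForm-ext e e′ (∀₁ x A)  h = cong ∀ₙ (nForm-ext _ _ A (binder-ext e e′ x h))
  nForm-ext e e′ (∃₁ x A)  h = cong ∃ₙ (nForm-ext _ _ A (binder-ext e e′ x h))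

  nCode-ext : ∀ E₁ E₁′ E₂ E₂′ A → (∀ z → z ∈ fv2ᵢ A → E₁ z ≡ E₁′ z)
              → (∀ m Y → (m , Y) ∈ fv2ₛ A → E₂ m Y ≡ E₂′ m Y) → nCode E₁ E₂ A ≡ nCode E₁′ E₂′ A
  nCode-ext E₁ E₁′ E₂ E₂′ ⊥₂          h₁ h₂ = refl
  nCode-ext E₁ E₁′ E₂ E₂′ (SV n X ts) h₁ h₂ = cong (Apₙ n) (cong₂ _∷_ (h₂ n X (here refl)) (nTerms-ext E₁ E₁′ ts h₁))
  nCode-ext E₁ E₁′ E₂ E₂′ (A ⇒₂ B)    h₁ h₂ = cong₂ _⇒ₙ_
    (nCode-ext E₁ E₁′ E₂ E₂′ A (λ z p → h₁ z (∈-++⁺ˡ p)) (λ m Y p → h₂ m Y (∈-++⁺ˡ p)))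
    (nCode-ext E₁ E₁′ E₂ E₂′ B (λ z p → h₁ z (∈-++⁺ʳ (fv2ᵢ A) p)) (λ m Y p → h₂ m Y (∈-++⁺ʳ (fv2ₛ A) p)))
  nCode-ext E₁ E₁′ E₂ E₂′ (A ∧₂ B)    h₁ h₂ = cong₂ _∧ₙ_
    (nCode-ext E₁ E₁′ E₂ E₂′ A (λ z p → h₁ z (∈-++⁺ˡ p)) (λ m Y p → h₂ m Y (∈-++⁺ˡ p)))
    (nCode-ext E₁ E₁′ E₂ E₂′ B (λ z p → h₁ z (∈-++⁺ʳ (fv2ᵢ A) p)) (λ m Y p → h₂ m Y (∈-++⁺ʳ (fv2ₛ A) p)))
  nCode-ext E₁ E₁′ E₂ E₂′ (A ∨₂ B)    h₁ h₂ = cong₂ _∨ₙ_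
    (nCode-ext E₁ E₁′ E₂ E₂′ A (λ z p → h₁ z (∈-++⁺ˡ p)) (λ m Y p → h₂ m Y (∈-++⁺ˡ p)))
    (nCode-ext E₁ E₁′ E₂ E₂′ B (λ z p → h₁ z (∈-++⁺ʳ (fv2ᵢ A) p)) (λ m Y p → h₂ m Y (∈-++⁺ʳ (fv2ₛ A) p)))
  nCode-ext E₁ E₁′ E₂ E₂′ (∀ᵢ x A)    h₁ h₂ = cong ∀ₙ (nCode-ext _ _ _ _ A (binder-ext E₁ E₁′ x h₁) (λ m Y p → cong shift (h₂ m Y p)))
  nCode-ext E₁ E₁′ E₂ E₂′ (∃ᵢ x A)    h₁ h₂ = cong ∃ₙ (nCode-ext _ _ _ _ A (binder-ext E₁ E₁′ x h₁) (λ m Y p → cong shift (h₂ m Y p)))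
  nCode-ext E₁ E₁′ E₂ E₂′ (∀ₛ n X A)  h₁ h₂ = cong ∀ₙ (nCode-ext _ _ _ _ A (λ z p → cong shift (h₁ z p)) (binder₂-ext E₂ E₂′ n X h₂))
  nCode-ext E₁ E₁′ E₂ E₂′ (∃ₛ n X A)  h₁ h₂ = cong ∃ₙ (nCode-ext _ _ _ _ A (λ z p → cong shift (h₁ z p)) (binder₂-ext E₂ E₂′ n X h₂))

  nsub-binder : ∀ b f (e : ℕ → NTerm ar) x z
                → nsub (liftᵇ b) (shift₁ f) ((shift₁ e [ x ↦ bound 0 ]) z) ≡ (shift₁ (λ w → nsub b f (e w)) [ x ↦ bound 0 ]) z
  nsub-binder b f e x z = ↦-pointwise (nsub (liftᵇ b) (shift₁ f)) (λ v → v) (shift₁ e) (shift₁ (λ w → nsub b f (e w)))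
                                      x _ _ z refl (λ _ → nsub-shift b f (e z))

  nsub-binder₂ : ∀ b f (E : ℕ → ℕ → NTerm ar) n X m Y
                 → nsub (liftᵇ b) (shift₁ f) ((shift₂ E [ n , X ↦₂ bound 0 ]) m Y)
                   ≡ (shift₂ (λ m′ Y′ → nsub b f (E m′ Y′)) [ n , X ↦₂ bound 0 ]) m Y
  nsub-binder₂ b f E n X m Y = ↦₂-pointwise (nsub (liftᵇ b) (shift₁ f)) (λ v → v) (shift₂ E) (shift₂ (λ m′ Y′ → nsub b f (E m′ Y′)))
                                             n X _ _ m Y refl (λ _ → nsub-shift b f (E m Y))

  nsubF-nForm : ∀ b f e A → nsubF b f (nForm e A) ≡ nForm (λ z → nsub b f (e z)) A
  nsubF-nForm b f e ⊥₁        = refl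
  nsubF-nForm b f e (Ap n ts) = cong (Apₙ n) (nsubs-nTerms b f e ts)
  nsubF-nForm b f e (A ⇒₁ B)  = cong₂ _⇒ₙ_ (nsubF-nForm b f e A) (nsubF-nForm b f e B)
  nsubF-nForm b f e (A ∧₁ B)  = cong₂ _∧ₙ_ (nsubF-nForm b f e A) (nsubF-nForm b f e B)
  nsubF-nForm b f e (A ∨₁ B)  = cong₂ _∨ₙ_ (nsubF-nForm b f e A) (nsubF-nForm b f e B)
  nsubF-nForm b f e (∀₁ x A)  = cong ∀ₙ (trans (nsubF-nForm _ _ _ A) (nForm-ext _ _ A (λ z _ → nsub-binder b f e x z)))
  nsubF-nForm b f e (∃₁ x A)  = cong ∃ₙ (trans (nsubF-nForm _ _ _ A) (nForm-ext _ _ A (λ z _ → nsub-binder b f e x z)))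

  nsubF-nCode : ∀ b f E₁ E₂ A → nsubF b f (nCode E₁ E₂ A) ≡ nCode (λ z → nsub b f (E₁ z)) (λ m Y → nsub b f (E₂ m Y)) A
  nsubF-nCode b f E₁ E₂ ⊥₂          = refl
  nsubF-nCode b f E₁ E₂ (SV n X ts) = cong (Apₙ n) (cong (nsub b f (E₂ n X) ∷_) (nsubs-nTerms b f E₁ ts))
  nsubF-nCode b f E₁ E₂ (A ⇒₂ B)    = cong₂ _⇒ₙ_ (nsubF-nCode b f E₁ E₂ A) (nsubF-nCode b f E₁ E₂ B)
  nsubF-nCode b f E₁ E₂ (A ∧₂ B)    = cong₂ _∧ₙ_ (nsubF-nCode b f E₁ E₂ A) (nsubF-nCode b f E₁ E₂ B)
  nsubF-nCode b f E₁ E₂ (A ∨₂ B)    = cong₂ _∨ₙ_ (nsubF-nCode b f E₁ E₂ A) (nsubF-nCode b f E₁ E₂ B)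
  nsubF-nCode b f E₁ E₂ (∀ᵢ x A)    = cong ∀ₙ (trans (nsubF-nCode _ _ _ _ A) (nCode-ext _ _ _ _ A
    (λ z _ → nsub-binder b f E₁ x z) (λ m Y _ → nsub-shift b f (E₂ m Y))))
  nsubF-nCode b f E₁ E₂ (∃ᵢ x A)    = cong ∃ₙ (trans (nsubF-nCode _ _ _ _ A) (nCode-ext _ _ _ _ A
    (λ z _ → nsub-binder b f E₁ x z) (λ m Y _ → nsub-shift b f (E₂ m Y))))
  nsubF-nCode b f E₁ E₂ (∀ₛ n X A)  = cong ∀ₙ (trans (nsubF-nCode _ _ _ _ A) (nCode-ext _ _ _ _ A
    (λ z _ → nsub-shift b f (E₁ z)) (λ m Y _ → nsub-binder₂ b f E₂ n X m Y)))
  nsubF-nCode b f E₁ E₂ (∃ₛ n X A)  = cong ∃ₙ (trans (nsubF-nCode _ _ _ _ A) (nCode-ext _ _ _ _ A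
    (λ z _ → nsub-shift b f (E₁ z)) (λ m Y _ → nsub-binder₂ b f E₂ n X m Y)))

  nTerm-rename-bound : ∀ e (σ : ℕ → Term ar) x {y} A → y ∉ imgVars σ (remove x A) → ∀ z → z ∈ A
      → nTerm (shift₁ e [ y ↦ bound 0 ]) ((σ [ x ↦ var y ]) z) ≡ (shift₁ (λ w → nTerm e (σ w)) [ x ↦ bound 0 ]) z
  nTerm-rename-bound e σ x {y} A y∉ z z∈A =
    ↦-pointwise (nTerm (shift₁ e [ y ↦ bound 0 ])) (λ v → v) σ (shift₁ (λ w → nTerm e (σ w))) x (var y) (bound 0) z
      (↦-same (shift₁ e) y (bound 0))
      (λ z≢x → trans (nTerm-ext _ (shift₁ e) (σ z) (λ v v∈ → ↦-other (shift₁ e) y (bound 0)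
                        (λ { refl → y∉ (∈-concatMap⁺′ (λ w → tvars (σ w)) (∈-remove⁺ z∈A z≢x) v∈) })))
                     (sym (shift-nTerm e (σ z))))

  nForm-sub1 : ∀ e σ A → nForm e (sub1 σ A) ≡ nForm (λ z → nTerm e (σ z)) A
  nForm-sub1 e σ ⊥₁        = refl
  nForm-sub1 e σ (Ap n ts) = cong (Apₙ n) (nTerms-tsubs e σ ts)
  nForm-sub1 e σ (A ⇒₁ B)  = cong₂ _⇒ₙ_ (nForm-sub1 e σ A) (nForm-sub1 e σ B)
  nForm-sub1 e σ (A ∧₁ B)  = cong₂ _∧ₙ_ (nForm-sub1 e σ A) (nForm-sub1 e σ B)
  nForm-sub1 e σ (A ∨₁ B)  = cong₂ _∨ₙ_ (nForm-sub1 e σ A) (nForm-sub1 e σ B)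
  nForm-sub1 e σ (∀₁ x A)  = cong ∀ₙ (trans (nForm-sub1 _ _ A)
    (nForm-ext _ _ A (nTerm-rename-bound e σ x (fv1 A) (fresh-∉ _))))
  nForm-sub1 e σ (∃₁ x A)  = cong ∃ₙ (trans (nForm-sub1 _ _ A)
    (nForm-ext _ _ A (nTerm-rename-bound e σ x (fv1 A) (fresh-∉ _))))

  nCode-sub2t : ∀ E₁ E₂ σ A → nCode E₁ E₂ (sub2t σ A) ≡ nCode (λ z → nTerm E₁ (σ z)) E₂ A
  nCode-sub2t E₁ E₂ σ ⊥₂          = refl
  nCode-sub2t E₁ E₂ σ (SV n X ts) = cong (Apₙ n) (cong (E₂ n X ∷_) (nTerms-tsubs E₁ σ ts))
  nCode-sub2t E₁ E₂ σ (A ⇒₂ B)    = cong₂ _⇒ₙ_ (nCode-sub2t E₁ E₂ σ A) (nCode-sub2t E₁ E₂ σ B)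
  nCode-sub2t E₁ E₂ σ (A ∧₂ B)    = cong₂ _∧ₙ_ (nCode-sub2t E₁ E₂ σ A) (nCode-sub2t E₁ E₂ σ B)
  nCode-sub2t E₁ E₂ σ (A ∨₂ B)    = cong₂ _∨ₙ_ (nCode-sub2t E₁ E₂ σ A) (nCode-sub2t E₁ E₂ σ B)
  nCode-sub2t E₁ E₂ σ (∀ᵢ x A)    = cong ∀ₙ (trans (nCode-sub2t _ _ _ A)
    (nCode-ext _ _ _ _ A (nTerm-rename-bound E₁ σ x (fv2ᵢ A) (fresh-∉ _)) (λ _ _ _ → refl)))
  nCode-sub2t E₁ E₂ σ (∃ᵢ x A)    = cong ∃ₙ (trans (nCode-sub2t _ _ _ A)
    (nCode-ext _ _ _ _ A (nTerm-rename-bound E₁ σ x (fv2ᵢ A) (fresh-∉ _)) (λ _ _ _ → refl)))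
  nCode-sub2t E₁ E₂ σ (∀ₛ n X A)  = cong ∀ₙ (trans (nCode-sub2t _ _ _ A)
    (nCode-ext _ _ _ _ A (λ z _ → sym (shift-nTerm E₁ (σ z))) (λ _ _ _ → refl)))
  nCode-sub2t E₁ E₂ σ (∃ₛ n X A)  = cong ∃ₙ (trans (nCode-sub2t _ _ _ A)
    (nCode-ext _ _ _ _ A (λ z _ → sym (shift-nTerm E₁ (σ z))) (λ _ _ _ → refl)))

  code-binder₁ : ∀ e ρ₁ ρ₂ x A {y} → y ∉ codedFv ρ₁ ρ₂ (∀ᵢ x A)
    → nCode (λ z → (shift₁ e [ y ↦ bound 0 ]) ((ρ₁ [ x ↦ y ]) z)) (λ m Y → (shift₁ e [ y ↦ bound 0 ]) (ρ₂ m Y)) A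
      ≡ nCode (shift₁ (λ z → e (ρ₁ z)) [ x ↦ bound 0 ]) (shift₂ (λ m Y → e (ρ₂ m Y))) A
  code-binder₁ e ρ₁ ρ₂ x A {y} y∉ = nCode-ext _ _ _ _ A
    (λ z p → ↦-pointwise (shift₁ e [ y ↦ bound 0 ]) (λ v → v) ρ₁ (shift₁ (λ z → e (ρ₁ z))) x y (bound 0) z
       (↦-same (shift₁ e) y (bound 0))
       (λ z≢x → ↦-other (shift₁ e) y (bound 0) (λ eq → y∉ (subst (_∈ _) eq (∈-++⁺ˡ (∈-map⁺ ρ₁ (∈-remove⁺ p z≢x)))))))
    (λ m Y p → ↦-other (shift₁ e) y (bound 0) (λ eq → y∉ (subst (_∈ _) eq
       (∈-++⁺ʳ (L.map ρ₁ (remove x (fv2ᵢ A))) (∈-map⁺ (λ p → ρ₂ (proj₁ p) (proj₂ p)) p)))))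

  code-binder₂ : ∀ e ρ₁ ρ₂ n X A {y} → y ∉ codedFv ρ₁ ρ₂ (∀ₛ n X A)
    → nCode (λ z → (shift₁ e [ y ↦ bound 0 ]) (ρ₁ z)) (λ m Y → (shift₁ e [ y ↦ bound 0 ]) ((ρ₂ [ n , X ↦₂ y ]) m Y)) A
      ≡ nCode (shift₁ (λ z → e (ρ₁ z))) (shift₂ (λ m Y → e (ρ₂ m Y)) [ n , X ↦₂ bound 0 ]) A
  code-binder₂ e ρ₁ ρ₂ n X A {y} y∉ = nCode-ext _ _ _ _ A
    (λ z p → ↦-other (shift₁ e) y (bound 0) (λ eq → y∉ (subst (_∈ _) eq (∈-++⁺ˡ (∈-map⁺ ρ₁ p)))))
    (λ m Y p → ↦₂-pointwise (shift₁ e [ y ↦ bound 0 ]) (λ v → v) ρ₂ (shift₂ (λ m Y → e (ρ₂ m Y))) n X y (bound 0) m Y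
       (↦-same (shift₁ e) y (bound 0))
       (λ ne → ↦-other (shift₁ e) y (bound 0) (λ eq → y∉ (subst (_∈ _) eq
          (∈-++⁺ʳ (L.map ρ₁ (fv2ᵢ A)) (∈-map⁺ (λ p → ρ₂ (proj₁ p) (proj₂ p)) (∈-remove₂⁺ p ne)))))))

  nForm-code : ∀ e ρ₁ ρ₂ A → nForm e (code ρ₁ ρ₂ A) ≡ nCode (λ z → e (ρ₁ z)) (λ m Y → e (ρ₂ m Y)) A
  nForm-code e ρ₁ ρ₂ ⊥₂          = refl
  nForm-code e ρ₁ ρ₂ (SV n X ts) = cong (Apₙ n) (cong (e (ρ₂ n X) ∷_) (nTerms-tsubs e (λ z → var (ρ₁ z)) ts))
  nForm-code e ρ₁ ρ₂ (A ⇒₂ B)    = cong₂ _⇒ₙ_ (nForm-code e ρ₁ ρ₂ A) (nForm-code e ρ₁ ρ₂ B)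
  nForm-code e ρ₁ ρ₂ (A ∧₂ B)    = cong₂ _∧ₙ_ (nForm-code e ρ₁ ρ₂ A) (nForm-code e ρ₁ ρ₂ B)
  nForm-code e ρ₁ ρ₂ (A ∨₂ B)    = cong₂ _∨ₙ_ (nForm-code e ρ₁ ρ₂ A) (nForm-code e ρ₁ ρ₂ B)
  nForm-code e ρ₁ ρ₂ (∀ᵢ x A)    = cong ∀ₙ (trans (nForm-code _ _ ρ₂ A) (code-binder₁ e ρ₁ ρ₂ x A (fresh-∉ _)))
  nForm-code e ρ₁ ρ₂ (∃ᵢ x A)    = cong ∃ₙ (trans (nForm-code _ _ ρ₂ A) (code-binder₁ e ρ₁ ρ₂ x A (fresh-∉ _)))
  nForm-code e ρ₁ ρ₂ (∀ₛ n X A)  = cong ∀ₙ (trans (nForm-code _ ρ₁ _ A) (code-binder₂ e ρ₁ ρ₂ n X A (fresh-∉ _)))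
  nForm-code e ρ₁ ρ₂ (∃ₛ n X A)  = cong ∃ₙ (trans (nForm-code _ ρ₁ _ A) (code-binder₂ e ρ₁ ρ₂ n X A (fresh-∉ _)))

  nForm-instance : ∀ u R t → nForm free (R [ u ≔₁ t ]) ≡ nsubF (openWith (nTerm free t)) free (nForm (shift₁ free [ u ↦ bound 0 ]) R)
  nForm-instance u R t = trans (nForm-sub1 free (var [ u ↦ t ]) R)
    (trans (nForm-ext _ _ R λ z _ →
              ↦-pointwise (nTerm free) (nsub (openWith (nTerm free t)) free) var (shift₁ free) u t (bound 0) z refl (λ _ → refl))
           (sym (nsubF-nForm (openWith (nTerm free t)) free _ R)))

  -- R and B are the bodies of matching binders, over u and over x
  image-instance₁ : ∀ u R t ς r x B
    → nForm (shift₁ free [ u ↦ bound 0 ]) R ≡ nCode (shift₁ (λ z → nTerm free (ς z)) [ x ↦ bound 0 ]) (shift₂ (λ m Y → free (r m Y))) B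
    → nForm free (R [ u ≔₁ t ]) ≡ image (ς [ x ↦ t ]) r B
  image-instance₁ u R t ς r x B eq = trans (nForm-instance u R t) (trans (cong (nsubF (openWith (nTerm free t)) free) eq)
    (trans (nsubF-nCode (openWith (nTerm free t)) free _ _ B) (nCode-ext _ _ _ _ B
      (λ z _ → ↦-pointwise (nsub (openWith (nTerm free t)) free) (nTerm free) (shift₁ (λ z → nTerm free (ς z))) ς x (bound 0) t z refl
         (λ _ → openWith-shift _ (nTerm free (ς z))))
      (λ _ _ _ → refl))))

  -- R and B are the bodies of matching binders, over u and over (n , X)
  image-instance₂ : ∀ u R w ς r n X B
    → nForm (shift₁ free [ u ↦ bound 0 ]) R
      ≡ nCode (shift₁ (λ z → nTerm free (ς z))) (shift₂ (λ m Y → free (r m Y)) [ n , X ↦₂ bound 0 ]) B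
    → nForm free (R [ u ≔₁ var w ]) ≡ image ς (r [ n , X ↦₂ w ]) B
  image-instance₂ u R w ς r n X B eq = trans (nForm-instance u R (var w)) (trans (cong (nsubF (openWith (free w)) free) eq)
    (trans (nsubF-nCode (openWith (free w)) free _ _ B) (nCode-ext _ _ _ _ B
      (λ z _ → openWith-shift _ (nTerm free (ς z)))
      (λ m Y _ → ↦₂-pointwise (nsub (openWith (free w)) free) free (shift₂ (λ m Y → free (r m Y))) r n X (bound 0) w m Y
                   refl (λ _ → refl)))))

  -- a left inverse of nTerm free; bound indices, which it never produces, go to var 0
  mutual
    unnameT : NTerm ar → Term ar
    unnameT (bound i)  = var 0
    unnameT (free x)   = var x
    unnameT (fun g ls) = fun g (unnameTs ls)

    unnameTs : ∀ {m} → Vec (NTerm ar) m → Vec (Term ar) m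
    unnameTs []       = []
    unnameTs (l ∷ ls) = unnameT l ∷ unnameTs ls

  mutual
    unnameT-nTerm : ∀ t → unnameT (nTerm free t) ≡ t
    unnameT-nTerm (var x)    = refl
    unnameT-nTerm (fun g ts) = cong (fun g) (unnameTs-nTerms ts)

    unnameTs-nTerms : ∀ {m} (ts : Vec (Term ar) m) → unnameTs (nTerms free ts) ≡ ts
    unnameTs-nTerms []       = refl
    unnameTs-nTerms (t ∷ ts) = cong₂ _∷_ (unnameT-nTerm t) (unnameTs-nTerms ts)

  nForm⁻¹-Ap : ∀ R {n ls} → nForm free R ≡ Apₙ n ls → R ≡ Ap n (unnameTs ls)
  nForm⁻¹-Ap (Ap n ts) refl = cong (Ap n) (sym (unnameTs-nTerms ts))
  nForm⁻¹-Ap ⊥₁       ()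
  nForm⁻¹-Ap (_ ⇒₁ _) ()
  nForm⁻¹-Ap (_ ∧₁ _) ()
  nForm⁻¹-Ap (_ ∨₁ _) ()
  nForm⁻¹-Ap (∀₁ _ _) ()
  nForm⁻¹-Ap (∃₁ _ _) ()

  nForm-Ap-injective : ∀ R S {n ls} → nForm free R ≡ Apₙ n ls → nForm free S ≡ Apₙ n ls → R ≡ S
  nForm-Ap-injective R S eR eS = trans (nForm⁻¹-Ap R eR) (sym (nForm⁻¹-Ap S eS))

  nForm⁻¹-⊥ : ∀ (R : Form1 ar) → nForm free R ≡ ⊥ₙ → R ≡ ⊥₁
  nForm⁻¹-⊥ ⊥₁       _  = refl
  nForm⁻¹-⊥ (Ap _ _) ()
  nForm⁻¹-⊥ (_ ⇒₁ _) ()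
  nForm⁻¹-⊥ (_ ∧₁ _) ()
  nForm⁻¹-⊥ (_ ∨₁ _) ()
  nForm⁻¹-⊥ (∀₁ _ _) ()
  nForm⁻¹-⊥ (∃₁ _ _) ()

  BinaryPreimage : (Form1 ar → Form1 ar → Form1 ar) → Form1 ar → NForm ar → NForm ar → Set
  BinaryPreimage c R P₁ P₂ = Σ (Form1 ar) λ R₁ → Σ (Form1 ar) λ R₂ → (R ≡ c R₁ R₂) × (nForm free R₁ ≡ P₁) × (nForm free R₂ ≡ P₂)

  nForm⁻¹-⇒ : ∀ R {P Q} → nForm free R ≡ (P ⇒ₙ Q) → BinaryPreimage _⇒₁_ R P Q
  nForm⁻¹-⇒ (R₁ ⇒₁ R₂) refl = R₁ , R₂ , refl , refl , refl
  nForm⁻¹-⇒ ⊥₁       ()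
  nForm⁻¹-⇒ (Ap _ _) ()
  nForm⁻¹-⇒ (_ ∧₁ _) ()
  nForm⁻¹-⇒ (_ ∨₁ _) ()
  nForm⁻¹-⇒ (∀₁ _ _) ()
  nForm⁻¹-⇒ (∃₁ _ _) ()

  nForm⁻¹-∧ : ∀ R {P Q} → nForm free R ≡ (P ∧ₙ Q) → BinaryPreimage _∧₁_ R P Q
  nForm⁻¹-∧ (R₁ ∧₁ R₂) refl = R₁ , R₂ , refl , refl , refl
  nForm⁻¹-∧ ⊥₁       ()
  nForm⁻¹-∧ (Ap _ _) ()
  nForm⁻¹-∧ (_ ⇒₁ _) ()
  nForm⁻¹-∧ (_ ∨₁ _) ()
  nForm⁻¹-∧ (∀₁ _ _) ()
  nForm⁻¹-∧ (∃₁ _ _) ()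

  nForm⁻¹-∨ : ∀ R {P Q} → nForm free R ≡ (P ∨ₙ Q) → BinaryPreimage _∨₁_ R P Q
  nForm⁻¹-∨ (R₁ ∨₁ R₂) refl = R₁ , R₂ , refl , refl , refl
  nForm⁻¹-∨ ⊥₁       ()
  nForm⁻¹-∨ (Ap _ _) ()
  nForm⁻¹-∨ (_ ⇒₁ _) ()
  nForm⁻¹-∨ (_ ∧₁ _) ()
  nForm⁻¹-∨ (∀₁ _ _) ()
  nForm⁻¹-∨ (∃₁ _ _) ()

  BinderPreimage : (ℕ → Form1 ar → Form1 ar) → Form1 ar → NForm ar → Set
  BinderPreimage c R P = Σ ℕ λ u → Σ (Form1 ar) λ R′ → (R ≡ c u R′) × (nForm (shift₁ free [ u ↦ bound 0 ]) R′ ≡ P)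

  nForm⁻¹-∀ : ∀ R {P} → nForm free R ≡ ∀ₙ P → BinderPreimage ∀₁ R P
  nForm⁻¹-∀ (∀₁ u R′) refl = u , R′ , refl , refl
  nForm⁻¹-∀ ⊥₁       ()
  nForm⁻¹-∀ (Ap _ _) ()
  nForm⁻¹-∀ (_ ⇒₁ _) ()
  nForm⁻¹-∀ (_ ∧₁ _) ()
  nForm⁻¹-∀ (_ ∨₁ _) ()
  nForm⁻¹-∀ (∃₁ _ _) ()

  nForm⁻¹-∃ : ∀ R {P} → nForm free R ≡ ∃ₙ P → BinderPreimage ∃₁ R P
  nForm⁻¹-∃ (∃₁ u R′) refl = u , R′ , refl , refl
  nForm⁻¹-∃ ⊥₁       ()
  nForm⁻¹-∃ (Ap _ _) ()
  nForm⁻¹-∃ (_ ⇒₁ _) ()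
  nForm⁻¹-∃ (_ ∧₁ _) ()
  nForm⁻¹-∃ (_ ∨₁ _) ()
  nForm⁻¹-∃ (∀₁ _ _) ()

  -- Interderivability and α-equivalence

  cut : ∀ {k} {Δ : List (Form1 ar)} {A B} → (A ∷ Δ) ⊢₁[ k ] B → Δ ⊢₁[ k ] A → Δ ⊢₁[ k ] B
  cut d e = ⇒E (⇒I d) e

  ∀I-fresh : ∀ {k} {Δ : List (Form1 ar)} {x A} → (∀ w → Δ ⊢₁[ k ] (A [ x ≔₁ var w ])) → Δ ⊢₁[ k ] ∀₁ x A
  ∀I-fresh {Δ = Δ} {x} {A} premise =
    ∀I w (∉-++⁻ˡ (fresh-∉ avoid)) (∉-++⁻ʳ (fvCtx1 Δ) (fresh-∉ avoid)) (premise w)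
    where avoid = fvCtx1 Δ ++ fv1 (∀₁ x A)
          w = fresh avoid

  ∃E-fresh : ∀ {k} {Δ : List (Form1 ar)} {x A C} → Δ ⊢₁[ k ] ∃₁ x A
             → (∀ w → ((A [ x ≔₁ var w ]) ∷ Δ) ⊢₁[ k ] C) → Δ ⊢₁[ k ] C
  ∃E-fresh {Δ = Δ} {x} {A} {C} major minor =
    ∃E w (∉-++⁻ˡ (fresh-∉ avoid)) (∉-++⁻ˡ (∉-++⁻ʳ (fvCtx1 Δ) (fresh-∉ avoid)))
         (∉-++⁻ʳ (fv1 (∃₁ x A)) (∉-++⁻ʳ (fvCtx1 Δ) (fresh-∉ avoid))) major (minor w)
    where avoid = fvCtx1 Δ ++ (fv1 (∃₁ x A) ++ fv1 C)
          w = fresh avoid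

  ∀-mono : ∀ {k} {Δ : List (Form1 ar)} {u v R S} → ∀₁ u R ∈ Δ
           → (∀ w → ((R [ u ≔₁ var w ]) ∷ Δ) ⊢₁[ k ] (S [ v ≔₁ var w ])) → Δ ⊢₁[ k ] ∀₁ v S
  ∀-mono ∀R∈Δ step = ∀I-fresh λ w → cut (step w) (∀E (var w) (hyp ∀R∈Δ))

  ∃-mono : ∀ {k} {Δ : List (Form1 ar)} {u v R S} → ∃₁ u R ∈ Δ
           → (∀ w → ((R [ u ≔₁ var w ]) ∷ Δ) ⊢₁[ k ] (S [ v ≔₁ var w ])) → Δ ⊢₁[ k ] ∃₁ v S
  ∃-mono ∃R∈Δ step = ∃E-fresh (hyp ∃R∈Δ) λ w → ∃I (var w) (step w)

  -- Stated through membership rather than derivability so that it is stable under weakening,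
  -- for which the calculus has no rule.
  Interderivable : Logic → List (Form1 ar) → Form1 ar → Form1 ar → Set
  Interderivable k Δ₀ R S = ∀ Δ → Δ₀ ⊆ Δ → (R ∈ Δ → Δ ⊢₁[ k ] S) × (S ∈ Δ → Δ ⊢₁[ k ] R)

  ≡⇒interderivable : ∀ {k Δ₀ R S} → R ≡ S → Interderivable k Δ₀ R S
  ≡⇒interderivable refl Δ _ = hyp , hyp

  flip-interderivable : ∀ {k Δ₀ R S} → Interderivable k Δ₀ R S → Interderivable k Δ₀ S R
  flip-interderivable h Δ s = proj₂ (h Δ s) , proj₁ (h Δ s)

  ⇒-interderivable : ∀ {k Δ₀ R₁ R₂ S₁ S₂} → Interderivable k Δ₀ R₁ S₁ → Interderivable k Δ₀ R₂ S₂
                     → Interderivable k Δ₀ (R₁ ⇒₁ R₂) (S₁ ⇒₁ S₂)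
  ⇒-interderivable {R₁ = R₁} {R₂} {S₁} {S₂} h₁ h₂ Δ s =
    (λ m → ⇒I (cut (proj₁ (h₂ (R₂ ∷ S₁ ∷ Δ) (there ∘ there ∘ s)) (here refl))
                   (⇒E (hyp (there m)) (proj₂ (h₁ (S₁ ∷ Δ) (there ∘ s)) (here refl))))) ,
    (λ m → ⇒I (cut (proj₂ (h₂ (S₂ ∷ R₁ ∷ Δ) (there ∘ there ∘ s)) (here refl))
                   (⇒E (hyp (there m)) (proj₁ (h₁ (R₁ ∷ Δ) (there ∘ s)) (here refl)))))

  ∧-interderivable : ∀ {k Δ₀ R₁ R₂ S₁ S₂} → Interderivable k Δ₀ R₁ S₁ → Interderivable k Δ₀ R₂ S₂
                     → Interderivable k Δ₀ (R₁ ∧₁ R₂) (S₁ ∧₁ S₂)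
  ∧-interderivable {R₁ = R₁} {R₂} {S₁} {S₂} h₁ h₂ Δ s =
    (λ m → ∧I (cut (proj₁ (h₁ (R₁ ∷ Δ) (there ∘ s)) (here refl)) (∧E₁ (hyp m)))
              (cut (proj₁ (h₂ (R₂ ∷ Δ) (there ∘ s)) (here refl)) (∧E₂ (hyp m)))) ,
    (λ m → ∧I (cut (proj₂ (h₁ (S₁ ∷ Δ) (there ∘ s)) (here refl)) (∧E₁ (hyp m)))
              (cut (proj₂ (h₂ (S₂ ∷ Δ) (there ∘ s)) (here refl)) (∧E₂ (hyp m))))

  ∨-interderivable : ∀ {k Δ₀ R₁ R₂ S₁ S₂} → Interderivable k Δ₀ R₁ S₁ → Interderivable k Δ₀ R₂ S₂
                     → Interderivable k Δ₀ (R₁ ∨₁ R₂) (S₁ ∨₁ S₂)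
  ∨-interderivable {R₁ = R₁} {R₂} {S₁} {S₂} h₁ h₂ Δ s =
    (λ m → ∨E (hyp m) (∨I₁ (proj₁ (h₁ (R₁ ∷ Δ) (there ∘ s)) (here refl)))
                      (∨I₂ (proj₁ (h₂ (R₂ ∷ Δ) (there ∘ s)) (here refl)))) ,
    (λ m → ∨E (hyp m) (∨I₁ (proj₂ (h₁ (S₁ ∷ Δ) (there ∘ s)) (here refl)))
                      (∨I₂ (proj₂ (h₂ (S₂ ∷ Δ) (there ∘ s)) (here refl))))

  ∀-interderivable : ∀ {k Δ₀ u v R S} → (∀ w → Interderivable k Δ₀ (R [ u ≔₁ var w ]) (S [ v ≔₁ var w ]))
                     → Interderivable k Δ₀ (∀₁ u R) (∀₁ v S)
  ∀-interderivable h Δ s = (λ m → ∀-mono m (λ w → proj₁ (h w (_ ∷ Δ) (there ∘ s)) (here refl))) ,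
                           (λ m → ∀-mono m (λ w → proj₂ (h w (_ ∷ Δ) (there ∘ s)) (here refl)))

  ∃-interderivable : ∀ {k Δ₀ u v R S} → (∀ w → Interderivable k Δ₀ (R [ u ≔₁ var w ]) (S [ v ≔₁ var w ]))
                     → Interderivable k Δ₀ (∃₁ u R) (∃₁ v S)
  ∃-interderivable h Δ s = (λ m → ∃-mono m (λ w → proj₁ (h w (_ ∷ Δ) (there ∘ s)) (here refl))) ,
                           (λ m → ∃-mono m (λ w → proj₂ (h w (_ ∷ Δ) (there ∘ s)) (here refl)))

  transport : ∀ {k Δ₀} {Δ : List (Form1 ar)} {F F′} → Interderivable k Δ₀ F F′ → Δ₀ ⊆ Δ → Δ ⊢₁[ k ] F → Δ ⊢₁[ k ] F′
  transport {F = F} h s d = cut (proj₁ (h (F ∷ _) (there ∘ s)) (here refl)) d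

  transport⁻ : ∀ {k Δ₀} {Δ : List (Form1 ar)} {F F′} → Interderivable k Δ₀ F′ F → Δ₀ ⊆ Δ → Δ ⊢₁[ k ] F → Δ ⊢₁[ k ] F′
  transport⁻ {F = F} h s d = cut (proj₂ (h (F ∷ _) (there ∘ s)) (here refl)) d

  image-interderivable : ∀ k A Δ₀ ς r R S → nForm free R ≡ image ς r A → nForm free S ≡ image ς r A
                         → Interderivable k Δ₀ R S
  image-interderivable k ⊥₂ Δ₀ ς r R S eR eS
    rewrite nForm⁻¹-⊥ R eR | nForm⁻¹-⊥ S eS = ≡⇒interderivable refl
  image-interderivable k (SV n X ts) Δ₀ ς r R S eR eS = ≡⇒interderivable (nForm-Ap-injective R S eR eS)
  image-interderivable k (A ⇒₂ B) Δ₀ ς r R S eR eS with nForm⁻¹-⇒ R eR | nForm⁻¹-⇒ S eS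
  ... | R₁ , R₂ , refl , e₁ , e₂ | S₁ , S₂ , refl , f₁ , f₂ =
    ⇒-interderivable (image-interderivable k A Δ₀ ς r R₁ S₁ e₁ f₁) (image-interderivable k B Δ₀ ς r R₂ S₂ e₂ f₂)
  image-interderivable k (A ∧₂ B) Δ₀ ς r R S eR eS with nForm⁻¹-∧ R eR | nForm⁻¹-∧ S eS
  ... | R₁ , R₂ , refl , e₁ , e₂ | S₁ , S₂ , refl , f₁ , f₂ =
    ∧-interderivable (image-interderivable k A Δ₀ ς r R₁ S₁ e₁ f₁) (image-interderivable k B Δ₀ ς r R₂ S₂ e₂ f₂)
  image-interderivable k (A ∨₂ B) Δ₀ ς r R S eR eS with nForm⁻¹-∨ R eR | nForm⁻¹-∨ S eS
  ... | R₁ , R₂ , refl , e₁ , e₂ | S₁ , S₂ , refl , f₁ , f₂ =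
    ∨-interderivable (image-interderivable k A Δ₀ ς r R₁ S₁ e₁ f₁) (image-interderivable k B Δ₀ ς r R₂ S₂ e₂ f₂)
  image-interderivable k (∀ᵢ x A) Δ₀ ς r R S eR eS with nForm⁻¹-∀ R eR | nForm⁻¹-∀ S eS
  ... | u , R′ , refl , e | v , S′ , refl , f = ∀-interderivable λ w →
    image-interderivable k A Δ₀ (ς [ x ↦ var w ]) r _ _ (image-instance₁ u R′ (var w) ς r x A e) (image-instance₁ v S′ (var w) ς r x A f)
  image-interderivable k (∃ᵢ x A) Δ₀ ς r R S eR eS with nForm⁻¹-∃ R eR | nForm⁻¹-∃ S eS
  ... | u , R′ , refl , e | v , S′ , refl , f = ∃-interderivable λ w →
    image-interderivable k A Δ₀ (ς [ x ↦ var w ]) r _ _ (image-instance₁ u R′ (var w) ς r x A e) (image-instance₁ v S′ (var w) ς r x A f)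
  image-interderivable k (∀ₛ n X A) Δ₀ ς r R S eR eS with nForm⁻¹-∀ R eR | nForm⁻¹-∀ S eS
  ... | u , R′ , refl , e | v , S′ , refl , f = ∀-interderivable λ w →
    image-interderivable k A Δ₀ ς (r [ n , X ↦₂ w ]) _ _ (image-instance₂ u R′ w ς r n X A e) (image-instance₂ v S′ w ς r n X A f)
  image-interderivable k (∃ₛ n X A) Δ₀ ς r R S eR eS with nForm⁻¹-∃ R eR | nForm⁻¹-∃ S eS
  ... | u , R′ , refl , e | v , S′ , refl , f = ∃-interderivable λ w →
    image-interderivable k A Δ₀ ς (r [ n , X ↦₂ w ]) _ _ (image-instance₂ u R′ w ς r n X A e) (image-instance₂ v S′ w ς r n X A f)

  -- The substitution lemma

  bindAll-outside-ext : ∀ {m} (xs : Vec ℕ m) us (ς ς′ : ℕ → Term ar) z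
                        → (z ∉ V.toList xs → ς z ≡ ς′ z) → bindAll xs us ς z ≡ bindAll xs us ς′ z
  bindAll-outside-ext []       []       ς ς′ z h = h (λ ())
  bindAll-outside-ext (x ∷ xs) (u ∷ us) ς ς′ z h = bindAll-outside-ext xs us _ _ z λ z∉xs →
    ↦-pointwise (λ v → v) (λ v → v) ς ς′ x u u z refl (λ z≢x → h λ { (here e) → z≢x e ; (there p) → z∉xs p })

  bindAll-outside : ∀ {m} (xs : Vec ℕ m) us (ς : ℕ → Term ar) z → z ∉ V.toList xs → bindAll xs us ς z ≡ ς z
  bindAll-outside []       []       ς z h = refl
  bindAll-outside (x ∷ xs) (u ∷ us) ς z h =
    trans (bindAll-outside xs us _ z (λ p → h (there p))) (↦-other ς x u (λ e → h (here e)))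

  tsub-bindAll : ∀ {m} (xs : Vec ℕ m) us (σ θ : ℕ → Term ar) z
                 → tsub θ (bindAll xs us σ z) ≡ bindAll xs (tsubs θ us) (λ w → tsub θ (σ w)) z
  tsub-bindAll []       []       σ θ z = refl
  tsub-bindAll (x ∷ xs) (u ∷ us) σ θ z = trans (tsub-bindAll xs us _ θ z)
    (bindAll-outside-ext xs _ _ _ z (λ _ → ↦-pointwise (tsub θ) (λ v → v) σ (λ w → tsub θ (σ w)) x u (tsub θ u) z refl (λ _ → refl)))

  bindAll-vars : ∀ {m} (xs : Vec ℕ m) us (σ : ℕ → Term ar) → Distinct xs → tsubs (bindAll xs us σ) (V.map var xs) ≡ us
  bindAll-vars []       []       σ _          = refl
  bindAll-vars (x ∷ xs) (u ∷ us) σ (x∉xs , d) =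
    cong₂ _∷_ (trans (bindAll-outside xs us _ x x∉xs) (↦-same σ x u)) (bindAll-vars xs us _ d)

  nTerms-bindAll-vars : ∀ {m} (xs : Vec ℕ m) us (ς : ℕ → Term ar) → Distinct xs
                        → nTerms (λ z → nTerm free (bindAll xs us ς z)) (V.map var xs) ≡ nTerms free us
  nTerms-bindAll-vars xs us ς d = trans (sym (nTerms-tsubs free (bindAll xs us ς) (V.map var xs)))
                                        (cong (nTerms free) (bindAll-vars xs us ς d))

  ↦ₛ-same : ∀ (τ : (m : ℕ) → ℕ → Abs ar m) n X a → (τ [ n , X ↦ₛ a ]) n X ≡ a
  ↦ₛ-same τ n X a with n ≟ n
  ... | yes refl rewrite ≡ᵇ-refl X = refl
  ... | no n≢n   = ⊥-elim (n≢n refl)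

  ↦ₛ-other : ∀ (τ : (m : ℕ) → ℕ → Abs ar m) n X a {m Y} → (m , Y) ≢ (n , X) → (τ [ n , X ↦ₛ a ]) m Y ≡ τ m Y
  ↦ₛ-other τ n X a {m} {Y} ne with m ≟ n
  ... | yes refl rewrite ≡ᵇ-false (λ e → ne (cong (m ,_) e)) = refl
  ... | no _     = refl

  image-instAbs : ∀ {m} ς r (a : Abs ar m) us
                  → image ς r (instAbs a us) ≡ image (bindAll (Abs.params a) (tsubs ς us) ς) r (Abs.body a)
  image-instAbs ς r (abs xs G) us = trans (nCode-sub2t _ _ _ G) (nCode-ext _ _ _ _ G
    (λ z _ → trans (sym (nTerm-tsub free ς (bindAll xs us var z))) (cong (nTerm free) (tsub-bindAll xs us var ς z)))
    (λ _ _ _ → refl))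

  Realises : Logic → List (Form1 ar) → (ℕ → Term ar) → (ℕ → ℕ → ℕ) → ∀ {m} → Abs ar m → ℕ → Set
  Realises k Δ₀ ς r {m} a y = ∀ (us : Vec (Term ar) m) R S
    → nForm free R ≡ image (bindAll (Abs.params a) us ς) r (Abs.body a)
    → nForm free S ≡ Apₙ m (free y ∷ nTerms free us)
    → Interderivable k Δ₀ R S

  RealisesAll : Logic → List (Form1 ar) → (ℕ → Term ar) → (ℕ → ℕ → ℕ) → (ℕ → ℕ → ℕ)
                → ((m : ℕ) → ℕ → Abs ar m) → Form2 ar → Set
  RealisesAll k Δ₀ ς r r′ τ A = ∀ m Y → (m , Y) ∈ fv2ₛ A → Realises k Δ₀ ς r (τ m Y) (r′ m Y)

  absVar-realises : ∀ k Δ₀ ς r m Y {y} → r m Y ≡ y → Realises k Δ₀ ς r (absVar m Y) y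
  absVar-realises k Δ₀ ς r m Y r≡y us R S eR eS = ≡⇒interderivable (nForm-Ap-injective R S
    (trans eR (cong (Apₙ m) (cong₂ _∷_ (cong free r≡y) (nTerms-bindAll-vars (vars m) us ς (vars-distinct m))))) eS)

  -- the names that sub2 avoids when it renames a bound variable
  boundAvoidᵢ : (ℕ → Term ar) → ((n : ℕ) → ℕ → Abs ar n) → ℕ → Form2 ar → List ℕ
  boundAvoidᵢ σ τ x A = imgVars σ (remove x (fv2ᵢ A)) ++ L.concatMap (λ p → absFvᵢ (τ (proj₁ p) (proj₂ p))) (fv2ₛ A)

  boundAvoidₛ : ((n : ℕ) → ℕ → Abs ar n) → ℕ → ℕ → Form2 ar → List ℕ
  boundAvoidₛ τ n X A = L.concatMap (λ p → L.map proj₂ (absFvₛ (τ (proj₁ p) (proj₂ p)))) (remove₂ (n , X) (fv2ₛ A))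

  binderᵢ-terms : ∀ σ τ (ς ς′ : ℕ → Term ar) x A {y} w → y ∉ boundAvoidᵢ σ τ x A
    → (∀ z → z ∈ fv2ᵢ (∀ᵢ x A) → tsub ς (σ z) ≡ ς′ z)
    → ∀ z → z ∈ fv2ᵢ A → tsub (ς [ y ↦ var w ]) ((σ [ x ↦ var y ]) z) ≡ (ς′ [ x ↦ var w ]) z
  binderᵢ-terms σ τ ς ς′ x A {y} w y∉ hi z p =
    ↦-pointwise (tsub (ς [ y ↦ var w ])) (λ v → v) σ ς′ x (var y) (var w) z (↦-same ς y (var w)) λ z≢x →
      trans (tsub-ext _ ς (σ z) (λ v q → ↦-other ς y (var w)
              (λ { refl → y∉ (∈-++⁺ˡ (∈-concatMap⁺′ (λ u → tvars (σ u)) (∈-remove⁺ p z≢x) q)) })))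
            (hi z (∈-remove⁺ p z≢x))

  binderᵢ-realises : ∀ k Δ₀ σ τ ς r r′ x A {y} w → y ∉ boundAvoidᵢ σ τ x A
    → RealisesAll k Δ₀ ς r r′ τ A → RealisesAll k Δ₀ (ς [ y ↦ var w ]) r r′ τ A
  binderᵢ-realises k Δ₀ σ τ ς r r′ x A {y} w y∉ hr m Y p us R S eR =
    hr m Y p us R S (trans eR (nCode-ext _ _ _ _ (Abs.body (τ m Y)) (λ z q →
      cong (nTerm free) (bindAll-outside-ext (Abs.params (τ m Y)) us _ _ z λ z∉ → ↦-other ς y (var w) λ { refl →
        y∉ (∈-++⁺ʳ (imgVars σ (remove x (fv2ᵢ A))) (∈-concatMap⁺′ (λ p → absFvᵢ (τ (proj₁ p) (proj₂ p))) p
              (∈-filter⁺ (λ y → ¬? (Any.any? (λ x → y ≟ x) (V.toList (Abs.params (τ m Y))))) q z∉))) }))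
      (λ _ _ _ → refl)))

  binderₛ-realises : ∀ k Δ₀ τ ς r r′ n X A {Y} w → Y ∉ boundAvoidₛ τ n X A
    → RealisesAll k Δ₀ ς r r′ τ (∀ₛ n X A)
    → RealisesAll k Δ₀ ς (r [ n , Y ↦₂ w ]) (r′ [ n , X ↦₂ w ]) (τ [ n , X ↦ₛ absVar n Y ]) A
  binderₛ-realises k Δ₀ τ ς r r′ n X A {Y} w Y∉ hr m Z p with ≡-dec _≟_ _≟_ (m , Z) (n , X)
  ... | yes refl rewrite ↦ₛ-same τ n X (absVar n Y) =
    absVar-realises k Δ₀ ς (r [ n , Y ↦₂ w ]) n Y (trans (↦₂-same r n Y w) (sym (↦₂-same r′ n X w)))
  ... | no ne rewrite ↦ₛ-other τ n X (absVar n Y) ne = λ us R S eR eS →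
    hr m Z (∈-remove₂⁺ p ne) us R S
      (trans eR (nCode-ext _ _ _ _ _ (λ _ _ → refl) λ m′ Z′ q → cong free (↦₂-other r n Y w λ { refl →
         Y∉ (∈-concatMap⁺′ (λ p → L.map proj₂ (absFvₛ (τ (proj₁ p) (proj₂ p)))) (∈-remove₂⁺ p ne) (∈-map⁺ proj₂ q)) })))
      (trans eS (cong (λ v → Apₙ m (free v ∷ nTerms free us)) (↦₂-other r′ n X w ne)))

  substitution-interderivable : ∀ k A Δ₀ σ τ ς r ς′ r′
    → (∀ z → z ∈ fv2ᵢ A → tsub ς (σ z) ≡ ς′ z)
    → RealisesAll k Δ₀ ς r r′ τ A
    → ∀ R S → nForm free R ≡ image ς r (sub2 σ τ A) → nForm free S ≡ image ς′ r′ A → Interderivable k Δ₀ R S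
  substitution-interderivable k ⊥₂ Δ₀ σ τ ς r ς′ r′ hi hr R S eR eS
    rewrite nForm⁻¹-⊥ R eR | nForm⁻¹-⊥ S eS = ≡⇒interderivable refl
  substitution-interderivable k (SV n X ts) Δ₀ σ τ ς r ς′ r′ hi hr R S eR eS =
    hr n X (here refl) (tsubs ς (tsubs σ ts)) R S (trans eR (image-instAbs ς r (τ n X) (tsubs σ ts)))
       (trans eS (cong (λ us → Apₙ n (free (r′ n X) ∷ us)) args))
    where
    args : nTerms (λ z → nTerm free (ς′ z)) ts ≡ nTerms free (tsubs ς (tsubs σ ts))
    args = sym (trans (cong (nTerms free) (tsubs-tsubs ς σ ts))
                      (trans (nTerms-tsubs free _ ts) (nTerms-ext _ _ ts (λ z p → cong (nTerm free) (hi z p)))))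
  substitution-interderivable k (A ⇒₂ B) Δ₀ σ τ ς r ς′ r′ hi hr R S eR eS with nForm⁻¹-⇒ R eR | nForm⁻¹-⇒ S eS
  ... | R₁ , R₂ , refl , e₁ , e₂ | S₁ , S₂ , refl , f₁ , f₂ = ⇒-interderivable
    (substitution-interderivable k A Δ₀ σ τ ς r ς′ r′ (λ z p → hi z (∈-++⁺ˡ p)) (λ m Y p → hr m Y (∈-++⁺ˡ p)) R₁ S₁ e₁ f₁)
    (substitution-interderivable k B Δ₀ σ τ ς r ς′ r′ (λ z p → hi z (∈-++⁺ʳ (fv2ᵢ A) p)) (λ m Y p → hr m Y (∈-++⁺ʳ (fv2ₛ A) p))
                                 R₂ S₂ e₂ f₂)
  substitution-interderivable k (A ∧₂ B) Δ₀ σ τ ς r ς′ r′ hi hr R S eR eS with nForm⁻¹-∧ R eR | nForm⁻¹-∧ S eS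
  ... | R₁ , R₂ , refl , e₁ , e₂ | S₁ , S₂ , refl , f₁ , f₂ = ∧-interderivable
    (substitution-interderivable k A Δ₀ σ τ ς r ς′ r′ (λ z p → hi z (∈-++⁺ˡ p)) (λ m Y p → hr m Y (∈-++⁺ˡ p)) R₁ S₁ e₁ f₁)
    (substitution-interderivable k B Δ₀ σ τ ς r ς′ r′ (λ z p → hi z (∈-++⁺ʳ (fv2ᵢ A) p)) (λ m Y p → hr m Y (∈-++⁺ʳ (fv2ₛ A) p))
                                 R₂ S₂ e₂ f₂)
  substitution-interderivable k (A ∨₂ B) Δ₀ σ τ ς r ς′ r′ hi hr R S eR eS with nForm⁻¹-∨ R eR | nForm⁻¹-∨ S eS
  ... | R₁ , R₂ , refl , e₁ , e₂ | S₁ , S₂ , refl , f₁ , f₂ = ∨-interderivable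
    (substitution-interderivable k A Δ₀ σ τ ς r ς′ r′ (λ z p → hi z (∈-++⁺ˡ p)) (λ m Y p → hr m Y (∈-++⁺ˡ p)) R₁ S₁ e₁ f₁)
    (substitution-interderivable k B Δ₀ σ τ ς r ς′ r′ (λ z p → hi z (∈-++⁺ʳ (fv2ᵢ A) p)) (λ m Y p → hr m Y (∈-++⁺ʳ (fv2ₛ A) p))
                                 R₂ S₂ e₂ f₂)
  substitution-interderivable k (∀ᵢ x A) Δ₀ σ τ ς r ς′ r′ hi hr R S eR eS with nForm⁻¹-∀ R eR | nForm⁻¹-∀ S eS
  ... | u , R′ , refl , e | v , S′ , refl , f = ∀-interderivable λ w →
    substitution-interderivable k A Δ₀ (σ [ x ↦ var y ]) τ (ς [ y ↦ var w ]) r (ς′ [ x ↦ var w ]) r′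
      (binderᵢ-terms σ τ ς ς′ x A w (fresh-∉ _) hi) (binderᵢ-realises k Δ₀ σ τ ς r r′ x A w (fresh-∉ _) hr) _ _
      (image-instance₁ u R′ (var w) ς r y _ e) (image-instance₁ v S′ (var w) ς′ r′ x A f)
    where y = fresh (boundAvoidᵢ σ τ x A)
  substitution-interderivable k (∃ᵢ x A) Δ₀ σ τ ς r ς′ r′ hi hr R S eR eS with nForm⁻¹-∃ R eR | nForm⁻¹-∃ S eS
  ... | u , R′ , refl , e | v , S′ , refl , f = ∃-interderivable λ w →
    substitution-interderivable k A Δ₀ (σ [ x ↦ var y ]) τ (ς [ y ↦ var w ]) r (ς′ [ x ↦ var w ]) r′
      (binderᵢ-terms σ τ ς ς′ x A w (fresh-∉ _) hi) (binderᵢ-realises k Δ₀ σ τ ς r r′ x A w (fresh-∉ _) hr) _ _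
      (image-instance₁ u R′ (var w) ς r y _ e) (image-instance₁ v S′ (var w) ς′ r′ x A f)
    where y = fresh (boundAvoidᵢ σ τ x A)
  substitution-interderivable k (∀ₛ n X A) Δ₀ σ τ ς r ς′ r′ hi hr R S eR eS with nForm⁻¹-∀ R eR | nForm⁻¹-∀ S eS
  ... | u , R′ , refl , e | v , S′ , refl , f = ∀-interderivable λ w →
    substitution-interderivable k A Δ₀ σ (τ [ n , X ↦ₛ absVar n Y ]) ς (r [ n , Y ↦₂ w ]) ς′ (r′ [ n , X ↦₂ w ])
      hi (binderₛ-realises k Δ₀ τ ς r r′ n X A w (fresh-∉ _) hr) _ _
      (image-instance₂ u R′ w ς r n Y _ e) (image-instance₂ v S′ w ς′ r′ n X A f)
    where Y = fresh (boundAvoidₛ τ n X A)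
  substitution-interderivable k (∃ₛ n X A) Δ₀ σ τ ς r ς′ r′ hi hr R S eR eS with nForm⁻¹-∃ R eR | nForm⁻¹-∃ S eS
  ... | u , R′ , refl , e | v , S′ , refl , f = ∃-interderivable λ w →
    substitution-interderivable k A Δ₀ σ (τ [ n , X ↦ₛ absVar n Y ]) ς (r [ n , Y ↦₂ w ]) ς′ (r′ [ n , X ↦₂ w ])
      hi (binderₛ-realises k Δ₀ τ ς r r′ n X A w (fresh-∉ _) hr) _ _
      (image-instance₂ u R′ w ς r n Y _ e) (image-instance₂ v S′ w ς′ r′ n X A f)
    where Y = fresh (boundAvoidₛ τ n X A)

  -- Comprehension

  -- the environments after instantiating the closure ∀χ̄ by the variables ρ₁ x and ρ₂ m Y
  close₁ : (ℕ → ℕ) → List Var2 → (ℕ → Term ar) → ℕ → Term ar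
  close₁ ρ₁ []            ς = ς
  close₁ ρ₁ (inj₁ x ∷ χs) ς = close₁ ρ₁ χs (ς [ x ↦ var (ρ₁ x) ])
  close₁ ρ₁ (inj₂ _ ∷ χs) ς = close₁ ρ₁ χs ς

  close₂ : (ℕ → ℕ → ℕ) → List Var2 → (ℕ → ℕ → ℕ) → ℕ → ℕ → ℕ
  close₂ ρ₂ []                  r = r
  close₂ ρ₂ (inj₁ _ ∷ χs)       r = close₂ ρ₂ χs r
  close₂ ρ₂ (inj₂ (n , X) ∷ χs) r = close₂ ρ₂ χs (r [ n , X ↦₂ ρ₂ n X ])

  close₁-keeps : ∀ ρ₁ χs ς z → ς z ≡ var (ρ₁ z) → close₁ ρ₁ χs ς z ≡ var (ρ₁ z)
  close₁-keeps ρ₁ []            ς z e = e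
  close₁-keeps ρ₁ (inj₁ x ∷ χs) ς z e = close₁-keeps ρ₁ χs _ z (↦-agree ς (λ z → var (ρ₁ z)) x z e)
  close₁-keeps ρ₁ (inj₂ _ ∷ χs) ς z e = close₁-keeps ρ₁ χs ς z e

  close₁-∈ : ∀ ρ₁ χs ς {z} → inj₁ z ∈ χs → close₁ ρ₁ χs ς z ≡ var (ρ₁ z)
  close₁-∈ ρ₁ (inj₁ x ∷ χs) ς (here refl) = close₁-keeps ρ₁ χs _ x (↦-same ς x _)
  close₁-∈ ρ₁ (inj₁ x ∷ χs) ς (there p)   = close₁-∈ ρ₁ χs _ p
  close₁-∈ ρ₁ (inj₂ _ ∷ χs) ς (there p)   = close₁-∈ ρ₁ χs ς p

  close₂-keeps : ∀ ρ₂ χs r m Y → r m Y ≡ ρ₂ m Y → close₂ ρ₂ χs r m Y ≡ ρ₂ m Y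
  close₂-keeps ρ₂ []                  r m Y e = e
  close₂-keeps ρ₂ (inj₁ _ ∷ χs)       r m Y e = close₂-keeps ρ₂ χs r m Y e
  close₂-keeps ρ₂ (inj₂ (n , X) ∷ χs) r m Y e = close₂-keeps ρ₂ χs _ m Y (↦₂-agree r ρ₂ n X m Y e)

  close₂-∈ : ∀ ρ₂ χs r {m Y} → inj₂ (m , Y) ∈ χs → close₂ ρ₂ χs r m Y ≡ ρ₂ m Y
  close₂-∈ ρ₂ (inj₁ _ ∷ χs)       r (there p)   = close₂-∈ ρ₂ χs r p
  close₂-∈ ρ₂ (inj₂ (n , X) ∷ χs) r (here refl) = close₂-keeps ρ₂ χs _ n X (↦₂-same r n X _)
  close₂-∈ ρ₂ (inj₂ (n , X) ∷ χs) r (there p)   = close₂-∈ ρ₂ χs _ p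

  closeAll-elim : ∀ {k} {Γ : List (Form1 ar)} ρ₁ ρ₂ χs B ς r {H} → Γ ⊢₁[ k ] H → nForm free H ≡ image ς r (closeAll χs B)
    → Σ (Form1 ar) λ H′ → (Γ ⊢₁[ k ] H′) × (nForm free H′ ≡ image (close₁ ρ₁ χs ς) (close₂ ρ₂ χs r) B)
  closeAll-elim ρ₁ ρ₂ [] B ς r d e = _ , d , e
  closeAll-elim ρ₁ ρ₂ (inj₁ x ∷ χs) B ς r {H} d e with nForm⁻¹-∀ H e
  ... | u , H′ , refl , e′ = closeAll-elim ρ₁ ρ₂ χs B _ r (∀E (var (ρ₁ x)) d)
                               (image-instance₁ u H′ (var (ρ₁ x)) ς r x (closeAll χs B) e′)
  closeAll-elim ρ₁ ρ₂ (inj₂ (n , X) ∷ χs) B ς r {H} d e with nForm⁻¹-∀ H e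
  ... | u , H′ , refl , e′ = closeAll-elim ρ₁ ρ₂ χs B ς _ (∀E (var (ρ₂ n X)) d)
                               (image-instance₂ u H′ (ρ₂ n X) ς r n X (closeAll χs B) e′)

  allᵢ-elim : ∀ {k} {Γ : List (Form1 ar)} {m} (zs : Vec ℕ m) us B ς r {H} → Γ ⊢₁[ k ] H
    → nForm free H ≡ image ς r (allᵢ (V.toList zs) B)
    → Σ (Form1 ar) λ H′ → (Γ ⊢₁[ k ] H′) × (nForm free H′ ≡ image (bindAll zs us ς) r B)
  allᵢ-elim []       []       B ς r d e = _ , d , e
  allᵢ-elim (z ∷ zs) (u ∷ us) B ς r {H} d e with nForm⁻¹-∀ H e
  ... | v , H′ , refl , e′ = allᵢ-elim zs us B _ r (∀E u d) (image-instance₁ v H′ u ς r z (allᵢ (V.toList zs) B) e′)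

  closeAll-fvᵢ : ∀ χs (B : Form2 ar) {z} → z ∈ fv2ᵢ (closeAll χs B) → z ∈ fv2ᵢ B × inj₁ z ∉ χs
  closeAll-fvᵢ []            B p = p , λ ()
  closeAll-fvᵢ (inj₁ x ∷ χs) B p with ∈-remove⁻ (fv2ᵢ (closeAll χs B)) p
  ... | q , z≢x with closeAll-fvᵢ χs B q
  ... | z∈B , z∉χs = z∈B , λ { (here e) → z≢x (Sum.inj₁-injective e) ; (there r) → z∉χs r }
  closeAll-fvᵢ (inj₂ _ ∷ χs) B p with closeAll-fvᵢ χs B p
  ... | z∈B , z∉χs = z∈B , λ { (there r) → z∉χs r }

  closeAll-fvₛ : ∀ χs (B : Form2 ar) {p} → p ∈ fv2ₛ (closeAll χs B) → p ∈ fv2ₛ B × inj₂ p ∉ χs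
  closeAll-fvₛ []                  B q = q , λ ()
  closeAll-fvₛ (inj₁ _ ∷ χs)       B q with closeAll-fvₛ χs B q
  ... | p∈B , p∉χs = p∈B , λ { (there r) → p∉χs r }
  closeAll-fvₛ (inj₂ (n , X) ∷ χs) B q with ∈-remove₂⁻ (fv2ₛ (closeAll χs B)) q
  ... | q′ , p≢X with closeAll-fvₛ χs B q′
  ... | p∈B , p∉χs = p∈B , λ { (here e) → p≢X (Sum.inj₂-injective e) ; (there r) → p∉χs r }

  allᵢ-fvᵢ : ∀ xs (B : Form2 ar) {z} → z ∈ fv2ᵢ (allᵢ xs B) → z ∈ fv2ᵢ B
  allᵢ-fvᵢ []       B p = p
  allᵢ-fvᵢ (x ∷ xs) B p = allᵢ-fvᵢ xs B (proj₁ (∈-remove⁻ (fv2ᵢ (allᵢ xs B)) p))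

  fv2ₛ-allᵢ : ∀ xs (B : Form2 ar) → fv2ₛ (allᵢ xs B) ≡ fv2ₛ B
  fv2ₛ-allᵢ []       B = refl
  fv2ₛ-allᵢ (x ∷ xs) B = fv2ₛ-allᵢ xs B

  tsvars-map-var : ∀ {m} (xs : Vec ℕ m) {z} → z ∈ tsvars {ar} (V.map var xs) → z ∈ V.toList xs
  tsvars-map-var (x ∷ xs) (here e)  = here e
  tsvars-map-var (x ∷ xs) (there p) = there (tsvars-map-var xs p)

  -- The comprehension axiom  ∀χ̄ ∃Zⁿ ∀z̄ (G ↔ Zⁿ(z̄))  for  a = λx̄ B,  where G = B[x̄ := z̄] with z̄ and Z fresh.
  -- χ̄ closes over more than the free variables (also z̄ and those of the body of a): this is
  -- harmless and lets G-image treat every variable of the body alike.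
  module Comprehension {n} (a : Abs ar n) where

    zs : Vec ℕ n
    zs = upFrom (fresh (fv2ᵢ (Abs.body a))) n

    G : Form2 ar
    G = sub2t (bindAll (Abs.params a) (V.map var zs) var) (Abs.body a)

    χ₁ : List ℕ
    χ₁ = fv2ᵢ G ++ (V.toList zs ++ fv2ᵢ (Abs.body a))

    χ₂ : List (ℕ × ℕ)
    χ₂ = fv2ₛ G ++ fv2ₛ (Abs.body a)

    χs : List Var2
    χs = L.map inj₁ χ₁ ++ L.map inj₂ χ₂

    Z : ℕ
    Z = fresh (L.map proj₂ χ₂)

    matrix : Form2 ar
    matrix = allᵢ (V.toList zs) (G ⇔₂ SV n Z (V.map var zs))

    axiom : Form2 ar
    axiom = closeAll χs (∃ₛ n Z matrix)

    fv-body∈χs : ∀ {z} → z ∈ fv2ᵢ (Abs.body a) → inj₁ z ∈ χs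
    fv-body∈χs p = ∈-++⁺ˡ (∈-map⁺ inj₁ (∈-++⁺ʳ (fv2ᵢ G) (∈-++⁺ʳ (V.toList zs) p)))

    fvₛ-body∈χs : ∀ {m Y} → (m , Y) ∈ fv2ₛ (Abs.body a) → inj₂ (m , Y) ∈ χs
    fvₛ-body∈χs p = ∈-++⁺ʳ (L.map inj₁ χ₁) (∈-map⁺ inj₂ (∈-++⁺ʳ (fv2ₛ G) p))

    zs-fresh : ∀ {z} → z ∈ fv2ᵢ (Abs.body a) → z ∉ V.toList zs
    zs-fresh p q = <-irrefl refl (≤-trans (upFrom-≥ _ n q) (≤-foldr⊔ _ p))

    Z-fresh : ∀ {p} → p ∈ χ₂ → proj₂ p ≢ Z
    Z-fresh p refl = fresh-∉ (L.map proj₂ χ₂) (∈-map⁺ proj₂ p)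

    G-image : ∀ (ρ₁ : ℕ → ℕ) ρ₂ ς₁ r₁ b us
      → (∀ z → inj₁ z ∈ χs → ς₁ z ≡ var (ρ₁ z)) → (∀ m Y → inj₂ (m , Y) ∈ χs → r₁ m Y ≡ ρ₂ m Y)
      → image (bindAll zs us ς₁) (r₁ [ n , Z ↦₂ b ]) G ≡ image (bindAll (Abs.params a) us (λ z → var (ρ₁ z))) ρ₂ (Abs.body a)
    G-image ρ₁ ρ₂ ς₁ r₁ b us h₁ h₂ = trans (nCode-sub2t _ _ _ (Abs.body a)) (nCode-ext _ _ _ _ (Abs.body a)
      (λ z p → trans (sym (nTerm-tsub free θ (bindAll xs (V.map var zs) var z)))
        (cong (nTerm free) (trans (tsub-bindAll xs (V.map var zs) var θ z)
          (trans (cong (λ vs → bindAll xs vs θ z) (bindAll-vars zs us ς₁ (upFrom-distinct _ n)))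
                 (bindAll-outside-ext xs us θ (λ z → var (ρ₁ z)) z λ _ →
                    trans (bindAll-outside zs us ς₁ z (zs-fresh p)) (h₁ z (fv-body∈χs p)))))))
      (λ m Y p → cong free (trans (↦₂-other r₁ n Z b (λ { refl → Z-fresh (∈-++⁺ʳ (fv2ₛ G) p) refl }))
                                  (h₂ m Y (fvₛ-body∈χs p)))))
      where xs = Abs.params a
            θ = bindAll zs us ς₁

    matrix-realises : ∀ k ρ₁ ρ₂ ς₁ r₁ b H
      → (∀ z → inj₁ z ∈ χs → ς₁ z ≡ var (ρ₁ z)) → (∀ m Y → inj₂ (m , Y) ∈ χs → r₁ m Y ≡ ρ₂ m Y)
      → nForm free H ≡ image ς₁ (r₁ [ n , Z ↦₂ b ]) matrix
      → Realises k (H ∷ []) (λ z → var (ρ₁ z)) ρ₂ a b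
    matrix-realises k ρ₁ ρ₂ ς₁ r₁ b H h₁ h₂ eH us R S eR eS Δ H∈Δ
      with allᵢ-elim zs us (G ⇔₂ SV n Z (V.map var zs)) ς₁ (r₁ [ n , Z ↦₂ b ]) (hyp (H∈Δ (here refl))) eH
    ... | H₂ , d₂ , e₂ with nForm⁻¹-∧ H₂ e₂
    ... | _ , _ , refl , e⇒ , e⇐ with nForm⁻¹-⇒ _ e⇒ | nForm⁻¹-⇒ _ e⇐
    ... | P₁ , Q₁ , refl , eP₁ , eQ₁ | Q₂ , P₂ , refl , eQ₂ , eP₂ = forth , back
      where
      atom-image : image (bindAll zs us ς₁) (r₁ [ n , Z ↦₂ b ]) (SV n Z (V.map var zs)) ≡ Apₙ n (free b ∷ nTerms free us)
      atom-image = cong (Apₙ n) (cong₂ _∷_ (cong free (↦₂-same r₁ n Z b)) (nTerms-bindAll-vars zs us ς₁ (upFrom-distinct _ n)))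

      R⇔_ : ∀ {P} → nForm free P ≡ image (bindAll zs us ς₁) (r₁ [ n , Z ↦₂ b ]) G → Interderivable k [] R P
      R⇔ eP = image-interderivable k (Abs.body a) [] (bindAll (Abs.params a) us (λ z → var (ρ₁ z))) ρ₂ R _ eR
                (trans eP (G-image ρ₁ ρ₂ ς₁ r₁ b us h₁ h₂))

      forth : R ∈ Δ → Δ ⊢₁[ k ] S
      forth R∈Δ = subst (Δ ⊢₁[ k ]_) (nForm-Ap-injective Q₁ S (trans eQ₁ atom-image) eS)
                        (⇒E (∧E₁ d₂) (proj₁ ((R⇔ eP₁) Δ (λ ())) R∈Δ))

      back : S ∈ Δ → Δ ⊢₁[ k ] R
      back S∈Δ = cut (proj₂ ((R⇔ eP₂) (P₂ ∷ Δ) (λ ())) (here refl))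
                     (⇒E (∧E₂ d₂) (hyp (subst (_∈ Δ) (nForm-Ap-injective S Q₂ eS (trans eQ₂ atom-image)) S∈Δ)))

    axiom∈SC2 : SC2 axiom
    axiom∈SC2 = χs , n , Z , zs , G , refl , (no-members closedᵢ , no-members closedₛ) ,
                (λ z p → inj₂ (∈-++⁺ˡ (∈-map⁺ inj₁ (∈-++⁺ˡ p)))) , (λ p q → fvₛ-G∈χs q) , (λ q → Z-fresh (∈-++⁺ˡ q) refl)
      where
      no-members : ∀ {A : Set} {xs : List A} → (∀ {x} → x ∉ xs) → xs ≡ []
      no-members {xs = []}    _   = refl
      no-members {xs = x ∷ _} ∉xs = ⊥-elim (∉xs (here refl))

      fvₛ-G∈χs : ∀ {p} → p ∈ fv2ₛ G → inj₂ p ∈ χs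
      fvₛ-G∈χs q = ∈-++⁺ʳ (L.map inj₁ χ₁) (∈-map⁺ inj₂ (∈-++⁺ˡ q))

      ∈-⇔ : ∀ {A : Set} {v : A} xs ys → v ∈ (xs ++ ys) ++ (ys ++ xs) → v ∈ xs ⊎ v ∈ ys
      ∈-⇔ xs ys p with ∈-++⁻ (xs ++ ys) p
      ... | inj₁ q = ∈-++⁻ xs q
      ... | inj₂ q with ∈-++⁻ ys q
      ...   | inj₁ r = inj₂ r
      ...   | inj₂ r = inj₁ r

      closedᵢ : ∀ {z} → z ∉ fv2ᵢ axiom
      closedᵢ p with closeAll-fvᵢ χs (∃ₛ n Z matrix) p
      ... | q , z∉χs with ∈-⇔ (fv2ᵢ G) (tsvars (V.map var zs)) (allᵢ-fvᵢ (V.toList zs) _ q)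
      ...   | inj₁ z∈G  = z∉χs (∈-++⁺ˡ (∈-map⁺ inj₁ (∈-++⁺ˡ z∈G)))
      ...   | inj₂ z∈zs = z∉χs (∈-++⁺ˡ (∈-map⁺ inj₁ (∈-++⁺ʳ (fv2ᵢ G) (∈-++⁺ˡ (tsvars-map-var zs z∈zs)))))

      closedₛ : ∀ {p} → p ∉ fv2ₛ axiom
      closedₛ q with closeAll-fvₛ χs (∃ₛ n Z matrix) q
      ... | q′ , p∉χs with ∈-remove₂⁻ (fv2ₛ matrix) q′
      ...   | q″ , p≢Z with ∈-⇔ (fv2ₛ G) ((n , Z) ∷ []) (subst (_ ∈_) (fv2ₛ-allᵢ (V.toList zs) _) q″)
      ...     | inj₁ p∈G        = p∉χs (fvₛ-G∈χs p∈G)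
      ...     | inj₂ (here p≡Z) = p≢Z p≡Z

    use-comprehension : ∀ {k} {Γ : List (Form1 ar)} φto ρ₁ ρ₂ {C} → code (λ x → x) φto axiom ∈ Γ
      → (∀ b H → Realises k (H ∷ []) (λ z → var (ρ₁ z)) ρ₂ a b → (H ∷ Γ) ⊢₁[ k ] C)
      → Γ ⊢₁[ k ] C
    use-comprehension {k} {Γ} φto ρ₁ ρ₂ {C} ax∈Γ continue
      with closeAll-elim ρ₁ ρ₂ χs (∃ₛ n Z matrix) var φto (hyp ax∈Γ) (nForm-code free (λ x → x) φto axiom)
    ... | H₁ , d₁ , e₁ with nForm⁻¹-∃ H₁ e₁
    ... | u , H′ , refl , e′ = ∃E-fresh d₁ λ b →
      continue b _ (matrix-realises k ρ₁ ρ₂ ς₁ r₁ b _ (λ z → close₁-∈ ρ₁ χs var) (λ m Y → close₂-∈ ρ₂ χs φto)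
                      (image-instance₂ u H′ b ς₁ r₁ n Z matrix e′))
      where
      ς₁ = close₁ ρ₁ χs var
      r₁ = close₂ ρ₂ χs φto

  -- Translating derivations

  -- code ρ₁ ρ₂ (Qᵢ x A) = Q y₀ (code (ρ₁ [ x ↦ y₀ ]) ρ₂ A)  for  y₀ = codeBinder₁ ρ₁ ρ₂ x A;  likewise for Qₛ
  codeBinder₁ : (ℕ → ℕ) → (ℕ → ℕ → ℕ) → ℕ → Form2 ar → ℕ
  codeBinder₁ ρ₁ ρ₂ x A = fresh (codedFv ρ₁ ρ₂ (∀ᵢ x A))

  codeInstance₁ : (ℕ → ℕ) → (ℕ → ℕ → ℕ) → ℕ → Form2 ar → Term ar → Form1 ar
  codeInstance₁ ρ₁ ρ₂ x A t = code (ρ₁ [ x ↦ y₀ ]) ρ₂ A [ y₀ ≔₁ t ]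
    where y₀ = codeBinder₁ ρ₁ ρ₂ x A

  codeBinder₂ : (ℕ → ℕ) → (ℕ → ℕ → ℕ) → ℕ → ℕ → Form2 ar → ℕ
  codeBinder₂ ρ₁ ρ₂ n X A = fresh (codedFv ρ₁ ρ₂ (∀ₛ n X A))

  codeInstance₂ : (ℕ → ℕ) → (ℕ → ℕ → ℕ) → ℕ → ℕ → Form2 ar → ℕ → Form1 ar
  codeInstance₂ ρ₁ ρ₂ n X A w = code ρ₁ (ρ₂ [ n , X ↦₂ y₀ ]) A [ y₀ ≔₁ var w ]
    where y₀ = codeBinder₂ ρ₁ ρ₂ n X A

  codeInstance₁-image : ∀ ρ₁ ρ₂ x A t → nForm free (codeInstance₁ ρ₁ ρ₂ x A t) ≡ image ((λ z → var (ρ₁ z)) [ x ↦ t ]) ρ₂ A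
  codeInstance₁-image ρ₁ ρ₂ x A t = image-instance₁ _ _ t (λ z → var (ρ₁ z)) ρ₂ x A
    (trans (nForm-code _ _ ρ₂ A) (code-binder₁ free ρ₁ ρ₂ x A (fresh-∉ _)))

  codeInstance₂-image : ∀ ρ₁ ρ₂ n X A w → nForm free (codeInstance₂ ρ₁ ρ₂ n X A w) ≡ image (λ z → var (ρ₁ z)) (ρ₂ [ n , X ↦₂ w ]) A
  codeInstance₂-image ρ₁ ρ₂ n X A w = image-instance₂ _ _ w (λ z → var (ρ₁ z)) ρ₂ n X A
    (trans (nForm-code _ ρ₁ _ A) (code-binder₂ free ρ₁ ρ₂ n X A (fresh-∉ _)))

  code-substᵢ-interderivable : ∀ k A x t ρ₁ ρ₂ ρ₁′ t′
    → (∀ z → z ∈ fv2ᵢ A → z ≢ x → ρ₁′ z ≡ ρ₁ z) → tsub (λ z → var (ρ₁′ z)) t ≡ t′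
    → Interderivable k [] (code ρ₁′ ρ₂ (A [ x ≔ᵢ t ])) (codeInstance₁ ρ₁ ρ₂ x A t′)
  code-substᵢ-interderivable k A x t ρ₁ ρ₂ ρ₁′ t′ agree t↦t′ =
    substitution-interderivable k A [] (var [ x ↦ t ]) absVar (λ z → var (ρ₁′ z)) ρ₂ ((λ z → var (ρ₁ z)) [ x ↦ t′ ]) ρ₂
      (λ z p → ↦-pointwise (tsub (λ z → var (ρ₁′ z))) (λ v → v) var (λ z → var (ρ₁ z)) x t t′ z t↦t′ (λ z≢x → cong var (agree z p z≢x)))
      (λ m Y _ → absVar-realises k [] _ ρ₂ m Y refl)
      _ _ (nForm-code free ρ₁′ ρ₂ (A [ x ≔ᵢ t ])) (codeInstance₁-image ρ₁ ρ₂ x A t′)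

  code-substₛ-interderivable : ∀ k A n X (a : Abs ar n) ρ₁ ρ₂ ρ₂′ w Δ₀
    → Realises k Δ₀ (λ z → var (ρ₁ z)) ρ₂′ a w → (∀ m Y → (m , Y) ∈ fv2ₛ A → (m , Y) ≢ (n , X) → ρ₂′ m Y ≡ ρ₂ m Y)
    → Interderivable k Δ₀ (code ρ₁ ρ₂′ (A [ n , X ≔ₛ a ])) (codeInstance₂ ρ₁ ρ₂ n X A w)
  code-substₛ-interderivable k A n X a ρ₁ ρ₂ ρ₂′ w Δ₀ a↦w agree =
    substitution-interderivable k A Δ₀ var (absVar [ n , X ↦ₛ a ]) (λ z → var (ρ₁ z)) ρ₂′ (λ z → var (ρ₁ z)) (ρ₂ [ n , X ↦₂ w ])
      (λ _ _ → refl) realised _ _ (nForm-code free ρ₁ ρ₂′ (A [ n , X ≔ₛ a ])) (codeInstance₂-image ρ₁ ρ₂ n X A w)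
    where
    realised : RealisesAll k Δ₀ (λ z → var (ρ₁ z)) ρ₂′ (ρ₂ [ n , X ↦₂ w ]) (absVar [ n , X ↦ₛ a ]) A
    realised m Y p with ≡-dec _≟_ _≟_ (m , Y) (n , X)
    ... | yes refl rewrite ↦ₛ-same absVar n X a = subst (Realises k Δ₀ _ ρ₂′ a) (sym (↦₂-same ρ₂ n X w)) a↦w
    ... | no ne    rewrite ↦ₛ-other absVar n X a ne =
      absVar-realises k Δ₀ _ ρ₂′ m Y (trans (agree m Y p ne) (sym (↦₂-other ρ₂ n X w ne)))

  code-rename₁ : ∀ k (D : Form2 ar) ρ₁ ρ₂ {y} w → y ∉ fv2ᵢ D → Interderivable k [] (code ρ₁ ρ₂ D) (code (ρ₁ [ y ↦ w ]) ρ₂ D)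
  code-rename₁ k D ρ₁ ρ₂ {y} w y∉D = image-interderivable k D [] (λ z → var (ρ₁ z)) ρ₂ _ _
    (nForm-code free ρ₁ ρ₂ D)
    (trans (nForm-code free (ρ₁ [ y ↦ w ]) ρ₂ D) (nCode-ext _ _ _ _ D
      (λ z p → cong free (↦-other ρ₁ y w λ { refl → y∉D p })) (λ _ _ _ → refl)))

  code-rename₂ : ∀ k (D : Form2 ar) ρ₁ ρ₂ {n Y} w → (n , Y) ∉ fv2ₛ D → Interderivable k [] (code ρ₁ ρ₂ D) (code ρ₁ (ρ₂ [ n , Y ↦₂ w ]) D)
  code-rename₂ k D ρ₁ ρ₂ {n} {Y} w Y∉D = image-interderivable k D [] (λ z → var (ρ₁ z)) ρ₂ _ _
    (nForm-code free ρ₁ ρ₂ D)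
    (trans (nForm-code free ρ₁ (ρ₂ [ n , Y ↦₂ w ]) D) (nCode-ext _ _ _ _ D
      (λ _ _ → refl) (λ m Z p → cong free (↦₂-other ρ₂ n Y w λ { refl → Y∉D p }))))

  code-fresh-instance₁ : ∀ k A x {y} ρ₁ ρ₂ w → y ∉ fv2ᵢ (∀ᵢ x A)
    → Interderivable k [] (code (ρ₁ [ y ↦ w ]) ρ₂ (A [ x ≔ᵢ var y ])) (codeInstance₁ ρ₁ ρ₂ x A (var w))
  code-fresh-instance₁ k A x {y} ρ₁ ρ₂ w y∉ = code-substᵢ-interderivable k A x (var y) ρ₁ ρ₂ (ρ₁ [ y ↦ w ]) (var w)
    (λ z p z≢x → ↦-other ρ₁ y w λ { refl → y∉ (∈-remove⁺ p z≢x) }) (cong var (↦-same ρ₁ y w))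

  code-term-instance : ∀ k A x t ρ₁ ρ₂
    → Interderivable k [] (code ρ₁ ρ₂ (A [ x ≔ᵢ t ])) (codeInstance₁ ρ₁ ρ₂ x A (tsub (λ z → var (ρ₁ z)) t))
  code-term-instance k A x t ρ₁ ρ₂ = code-substᵢ-interderivable k A x t ρ₁ ρ₂ ρ₁ _ (λ _ _ _ → refl) refl

  code-fresh-instance₂ : ∀ k A n X {Y} ρ₁ ρ₂ w → (n , Y) ∉ fv2ₛ (∀ₛ n X A)
    → Interderivable k [] (code ρ₁ (ρ₂ [ n , Y ↦₂ w ]) (A [ n , X ≔ₛ absVar n Y ])) (codeInstance₂ ρ₁ ρ₂ n X A w)
  code-fresh-instance₂ k A n X {Y} ρ₁ ρ₂ w Y∉ =
    code-substₛ-interderivable k A n X (absVar n Y) ρ₁ ρ₂ (ρ₂ [ n , Y ↦₂ w ]) w []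
      (absVar-realises k [] _ (ρ₂ [ n , Y ↦₂ w ]) n Y (↦₂-same ρ₂ n Y w))
      (λ m Z p ne → ↦₂-other ρ₂ n Y w λ { refl → Y∉ (∈-remove₂⁺ p ne) })

  code-realised-instance : ∀ k A n X (a : Abs ar n) ρ₁ ρ₂ b H → Realises k (H ∷ []) (λ z → var (ρ₁ z)) ρ₂ a b
    → Interderivable k (H ∷ []) (code ρ₁ ρ₂ (A [ n , X ≔ₛ a ])) (codeInstance₂ ρ₁ ρ₂ n X A b)
  code-realised-instance k A n X a ρ₁ ρ₂ b H a↦b =
    code-substₛ-interderivable k A n X a ρ₁ ρ₂ ρ₂ b (H ∷ []) a↦b (λ _ _ _ _ → refl)

  CodedIn : Logic → List (Form2 ar) → (ℕ → ℕ) → (ℕ → ℕ → ℕ) → List (Form1 ar) → Set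
  CodedIn k Δ ρ₁ ρ₂ Γ′ = ∀ {D} → D ∈ Δ → Σ (Form1 ar) λ D′ → D′ ∈ Γ′ × (∀ Δ′ → D′ ∈ Δ′ → Δ′ ⊢₁[ k ] code ρ₁ ρ₂ D)

  codedIn-∷ : ∀ {k Δ ρ₁ ρ₂ Γ′ A F} → Interderivable k [] F (code ρ₁ ρ₂ A)
              → CodedIn k Δ ρ₁ ρ₂ Γ′ → CodedIn k (A ∷ Δ) ρ₁ ρ₂ (F ∷ Γ′)
  codedIn-∷ F⇔A coded (here refl) = _ , here refl , λ Δ′ F∈Δ′ → proj₁ (F⇔A Δ′ (λ ())) F∈Δ′
  codedIn-∷ F⇔A coded (there D∈Δ) = let D′ , D′∈Γ′ , yields = coded D∈Δ in D′ , there D′∈Γ′ , yields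

  codedIn-there : ∀ {k Δ ρ₁ ρ₂ Γ′ F} → CodedIn k Δ ρ₁ ρ₂ Γ′ → CodedIn k Δ ρ₁ ρ₂ (F ∷ Γ′)
  codedIn-there coded D∈Δ = let D′ , D′∈Γ′ , yields = coded D∈Δ in D′ , there D′∈Γ′ , yields

  codedIn-rename₁ : ∀ {k Δ ρ₁ ρ₂ Γ′ y} w → y ∉ fvCtx2ᵢ Δ → CodedIn k Δ ρ₁ ρ₂ Γ′ → CodedIn k Δ (ρ₁ [ y ↦ w ]) ρ₂ Γ′
  codedIn-rename₁ {k} {Δ} {ρ₁} {ρ₂} w y∉Δ coded {D} D∈Δ = let D′ , D′∈Γ′ , yields = coded D∈Δ in
    D′ , D′∈Γ′ , λ Δ′ D′∈Δ′ → transport (code-rename₁ k D ρ₁ ρ₂ w (λ p → y∉Δ (∈-concatMap⁺′ fv2ᵢ D∈Δ p))) (λ ()) (yields Δ′ D′∈Δ′)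

  codedIn-rename₂ : ∀ {k Δ ρ₁ ρ₂ Γ′ n Y} w → (n , Y) ∉ fvCtx2ₛ Δ → CodedIn k Δ ρ₁ ρ₂ Γ′ → CodedIn k Δ ρ₁ (ρ₂ [ n , Y ↦₂ w ]) Γ′
  codedIn-rename₂ {k} {Δ} {ρ₁} {ρ₂} w Y∉Δ coded {D} D∈Δ = let D′ , D′∈Γ′ , yields = coded D∈Δ in
    D′ , D′∈Γ′ , λ Δ′ D′∈Δ′ → transport (code-rename₂ k D ρ₁ ρ₂ w (λ p → Y∉Δ (∈-concatMap⁺′ fv2ₛ D∈Δ p))) (λ ()) (yields Δ′ D′∈Δ′)

  abstractionsOf : ∀ {Δ : List (Form2 ar)} {k A} → Δ ⊢₂[ k ] A → List (Σ ℕ (Abs ar))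
  abstractionsOf (hyp _)              = []
  abstractionsOf (⊥E d)               = abstractionsOf d
  abstractionsOf (raa d)              = abstractionsOf d
  abstractionsOf (⇒I d)               = abstractionsOf d
  abstractionsOf (⇒E d e)             = abstractionsOf d ++ abstractionsOf e
  abstractionsOf (∧I d e)             = abstractionsOf d ++ abstractionsOf e
  abstractionsOf (∧E₁ d)              = abstractionsOf d
  abstractionsOf (∧E₂ d)              = abstractionsOf d
  abstractionsOf (∨I₁ d)              = abstractionsOf d
  abstractionsOf (∨I₂ d)              = abstractionsOf d
  abstractionsOf (∨E d e f)           = abstractionsOf d ++ (abstractionsOf e ++ abstractionsOf f)
  abstractionsOf (∀I _ _ _ d)         = abstractionsOf d
  abstractionsOf (∀E _ d)             = abstractionsOf d
  abstractionsOf (∃I _ d)             = abstractionsOf d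
  abstractionsOf (∃E _ _ _ _ d e)     = abstractionsOf d ++ abstractionsOf e
  abstractionsOf (∀ₛI _ _ _ d)        = abstractionsOf d
  abstractionsOf (∀ₛE a d)            = (_ , a) ∷ abstractionsOf d
  abstractionsOf (∃ₛI a d)            = (_ , a) ∷ abstractionsOf d
  abstractionsOf (∃ₛE _ _ _ _ d e)    = abstractionsOf d ++ abstractionsOf e

  module Translation (φto : ℕ → ℕ → ℕ) where

    AxiomsIn : List (Σ ℕ (Abs ar)) → List (Form1 ar) → Set
    AxiomsIn as Γ′ = ∀ {n a} → (n , a) ∈ as → code (λ x → x) φto (Comprehension.axiom a) ∈ Γ′

    translate : ∀ {Δ k A} (d : Δ ⊢₂[ k ] A) ρ₁ ρ₂ Γ′ → CodedIn k Δ ρ₁ ρ₂ Γ′ → AxiomsIn (abstractionsOf d) Γ′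
                → Γ′ ⊢₁[ k ] code ρ₁ ρ₂ A
    translate (hyp D∈Δ) ρ₁ ρ₂ Γ′ coded ax = let _ , D′∈Γ′ , yields = coded D∈Δ in yields Γ′ D′∈Γ′
    translate (⊥E d)    ρ₁ ρ₂ Γ′ coded ax = ⊥E (translate d ρ₁ ρ₂ Γ′ coded ax)
    translate (raa d)   ρ₁ ρ₂ Γ′ coded ax = raa (translate d ρ₁ ρ₂ _ (codedIn-∷ (≡⇒interderivable refl) coded) (there ∘ ax))
    translate (⇒I d)    ρ₁ ρ₂ Γ′ coded ax = ⇒I (translate d ρ₁ ρ₂ _ (codedIn-∷ (≡⇒interderivable refl) coded) (there ∘ ax))
    translate (⇒E d e)  ρ₁ ρ₂ Γ′ coded ax =
      ⇒E (translate d ρ₁ ρ₂ Γ′ coded (ax ∘ ∈-++⁺ˡ)) (translate e ρ₁ ρ₂ Γ′ coded (ax ∘ ∈-++⁺ʳ _))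
    translate (∧I d e)  ρ₁ ρ₂ Γ′ coded ax =
      ∧I (translate d ρ₁ ρ₂ Γ′ coded (ax ∘ ∈-++⁺ˡ)) (translate e ρ₁ ρ₂ Γ′ coded (ax ∘ ∈-++⁺ʳ _))
    translate (∧E₁ d)   ρ₁ ρ₂ Γ′ coded ax = ∧E₁ (translate d ρ₁ ρ₂ Γ′ coded ax)
    translate (∧E₂ d)   ρ₁ ρ₂ Γ′ coded ax = ∧E₂ (translate d ρ₁ ρ₂ Γ′ coded ax)
    translate (∨I₁ d)   ρ₁ ρ₂ Γ′ coded ax = ∨I₁ (translate d ρ₁ ρ₂ Γ′ coded ax)
    translate (∨I₂ d)   ρ₁ ρ₂ Γ′ coded ax = ∨I₂ (translate d ρ₁ ρ₂ Γ′ coded ax)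
    translate (∨E d e f) ρ₁ ρ₂ Γ′ coded ax =
      ∨E (translate d ρ₁ ρ₂ Γ′ coded (ax ∘ ∈-++⁺ˡ))
         (translate e ρ₁ ρ₂ _ (codedIn-∷ (≡⇒interderivable refl) coded) (there ∘ ax ∘ ∈-++⁺ʳ (abstractionsOf d) ∘ ∈-++⁺ˡ))
         (translate f ρ₁ ρ₂ _ (codedIn-∷ (≡⇒interderivable refl) coded)
                    (there ∘ ax ∘ ∈-++⁺ʳ (abstractionsOf d) ∘ ∈-++⁺ʳ (abstractionsOf e)))
    translate {k = k} (∀I {x = x} {A = A} y y∉Δ y∉A d) ρ₁ ρ₂ Γ′ coded ax =
      ∀I-fresh λ w → transport (code-fresh-instance₁ k A x ρ₁ ρ₂ w y∉A) (λ ())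
                       (translate d (ρ₁ [ y ↦ w ]) ρ₂ Γ′ (codedIn-rename₁ w y∉Δ coded) ax)
    translate {k = k} (∀E {x = x} {A = A} t d) ρ₁ ρ₂ Γ′ coded ax =
      transport⁻ (code-term-instance k A x t ρ₁ ρ₂) (λ ()) (∀E _ (translate d ρ₁ ρ₂ Γ′ coded ax))
    translate {k = k} (∃I {x = x} {A = A} t d) ρ₁ ρ₂ Γ′ coded ax =
      ∃I _ (transport (code-term-instance k A x t ρ₁ ρ₂) (λ ()) (translate d ρ₁ ρ₂ Γ′ coded ax))
    translate {k = k} (∃E {x = x} {A = A} {C = C} y y∉Δ y∉A y∉C d e) ρ₁ ρ₂ Γ′ coded ax =
      ∃E-fresh (translate d ρ₁ ρ₂ Γ′ coded (ax ∘ ∈-++⁺ˡ)) λ w →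
        transport⁻ (code-rename₁ k C ρ₁ ρ₂ w y∉C) (λ ())
          (translate e (ρ₁ [ y ↦ w ]) ρ₂ _
             (codedIn-∷ (flip-interderivable (code-fresh-instance₁ k A x ρ₁ ρ₂ w y∉A)) (codedIn-rename₁ w y∉Δ coded))
             (there ∘ ax ∘ ∈-++⁺ʳ (abstractionsOf d)))
    translate {k = k} (∀ₛI {n = n} {X = X} {A = A} Y Y∉Δ Y∉A d) ρ₁ ρ₂ Γ′ coded ax =
      ∀I-fresh λ w → transport (code-fresh-instance₂ k A n X ρ₁ ρ₂ w Y∉A) (λ ())
                       (translate d ρ₁ (ρ₂ [ n , Y ↦₂ w ]) Γ′ (codedIn-rename₂ w Y∉Δ coded) ax)
    translate {k = k} (∀ₛE {n = n} {X = X} {A = A} a d) ρ₁ ρ₂ Γ′ coded ax =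
      Comprehension.use-comprehension a φto ρ₁ ρ₂ (ax (here refl)) λ b H a↦b →
        transport⁻ (code-realised-instance k A n X a ρ₁ ρ₂ b H a↦b) (λ { (here refl) → here refl })
          (∀E (var b) (translate d ρ₁ ρ₂ (H ∷ Γ′) (codedIn-there coded) (there ∘ ax ∘ there)))
    translate {k = k} (∃ₛI {n = n} {X = X} {A = A} a d) ρ₁ ρ₂ Γ′ coded ax =
      Comprehension.use-comprehension a φto ρ₁ ρ₂ (ax (here refl)) λ b H a↦b →
        ∃I (var b) (transport (code-realised-instance k A n X a ρ₁ ρ₂ b H a↦b) (λ { (here refl) → here refl })
                     (translate d ρ₁ ρ₂ (H ∷ Γ′) (codedIn-there coded) (there ∘ ax ∘ there)))
    translate {k = k} (∃ₛE {n = n} {X = X} {A = A} {C = C} Y Y∉Δ Y∉A Y∉C d e) ρ₁ ρ₂ Γ′ coded ax =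
      ∃E-fresh (translate d ρ₁ ρ₂ Γ′ coded (ax ∘ ∈-++⁺ˡ)) λ w →
        transport⁻ (code-rename₂ k C ρ₁ ρ₂ w Y∉C) (λ ())
          (translate e ρ₁ (ρ₂ [ n , Y ↦₂ w ]) _
             (codedIn-∷ (flip-interderivable (code-fresh-instance₂ k A n X ρ₁ ρ₂ w Y∉A)) (codedIn-rename₂ w Y∉Δ coded))
             (there ∘ ax ∘ ∈-++⁺ʳ (abstractionsOf d)))

theorem1 : (ar : ℕ → ℕ) (φ : (n : ℕ) → ℕ ⤖ ℕ) (Γ : Form2 ar → Set) (A : Form2 ar) (k : Logic)
           → Γ ⊩₂[ k ] A
           → ((Γ *ˢ⟨ φ ⟩) ∪ SC1 φ) ⊩₁[ k ] (A *⟨ φ ⟩)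
theorem1 ar φ Γ A k (Δ , Δ⊆Γ , d) = Δ* ++ axioms , All.tabulate hypotheses , translate d (λ x → x) φto _ coded axioms-present
  where
  φto : ℕ → ℕ → ℕ
  φto n = Bijection.to (φ n)
  open Translation {ar} φto

  Δ* axioms : List (Form1 ar)
  Δ*     = L.map _*⟨ φ ⟩ Δ
  axioms = L.map (λ (_ , a) → Comprehension.axiom a *⟨ φ ⟩) (abstractionsOf d)

  coded : CodedIn k Δ (λ x → x) φto (Δ* ++ axioms)
  coded D∈Δ = _ , ∈-++⁺ˡ (∈-map⁺ _*⟨ φ ⟩ D∈Δ) , λ _ → hyp

  axioms-present : AxiomsIn (abstractionsOf d) (Δ* ++ axioms)
  axioms-present p = ∈-++⁺ʳ Δ* (∈-map⁺ _ p)

  hypotheses : ∀ {F} → F ∈ Δ* ++ axioms → ((Γ *ˢ⟨ φ ⟩) ∪ SC1 φ) F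
  hypotheses p with ∈-++⁻ Δ* p
  ... | inj₁ q = let D , D∈Δ , F≡D* = ∈-map⁻ _*⟨ φ ⟩ q in inj₁ (D , All.lookup Δ⊆Γ D∈Δ , F≡D*)
  ... | inj₂ q = let (_ , a) , _ , F≡a* = ∈-map⁻ _ q in inj₂ (Comprehension.axiom a , Comprehension.axiom∈SC2 a , F≡a*)
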